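{- For all integers $n,k\ge0$, $\sum_{\lambda\in\mathscr{T}_n^k}x^{w_{\mathscr{T}}^{\mathrm{ch}}(\lambda)}=\sum_{\lambda\in\widetilde{\mathcal{T}}_n^k}x^{w_{\widetilde{\mathcal{T}}}^{\leftarrow}(\lambda)}$; in particular both equal $\widehat{\mathscr{B}}_n^k(x)$.
   Context: $\widehat{\mathscr{B}}_n^k(x)=\sum_{j=0}^{\min(n,k)} j!\,(x+1)(x+2)\cdots(x+j)\,S(n+1,j+1)\,S(k+1,j+1)$, $S$ the Stirling numbers of the second kind. Colored symbols $i^r$ (red) and $j^b$ (blue), compared within a color by value. $\widetilde{\mathcal{T}}_n^k$ (packed alternative tableaux): partial fillings of an $(n+1)\times(k+1)$ rectangle with $\leftarrow$ and $\downarrow$ such that every cell pointed to by an arrow (strictly left of a $\leftarrow$ in its row, or strictly below a $\downarrow$ in its column) is empty, each row except the bottom row contains exactly one $\leftarrow$, each column except the leftmost contains exactly one $\downarrow$, the bottom row contains no $\leftarrow$, and the leftmost column contains no $\downarrow$. $w_{\widetilde{\mathcal{T}}}^{\leftarrow}(\lambda)$ = number of columns containing a $\leftarrow$ whose $\downarrow$ is in the bottom row. $\mathscr{T}_n^k$ (double alternative trees): pairs $(T_1,T_2)$ of labeled rooted trees whose vertex sets partition $\{0^r,1^r,\dots,n^r,0^b,1^b,\dots,k^b\}$, with roots $0^r$ for $T_1$ and $0^b$ for $T_2$, all children of red vertices blue and of blue vertices red, and every descendant of a vertex $v$ having the same color as $v$ is larger than $v$. $w_{\mathscr{T}}^{\mathrm{ch}}(\lambda)$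 = number of children of $0^r$ that are not leaves (a leaf is a vertex without children). -}

module Defs where

open import Data.Nat.Base using (ℕ; zero; suc; _+_; _*_; _⊓_; _≡ᵇ_; _<ᵇ_; _!)

open import Data.Fin.Base using (Fin; zero; suc; toℕ; fromℕ)
open import Data.Bool.Base using (Bool; true; false; _∧_; _∨_; not; if_then_else_)
open import Data.List.Base using (List; []; _∷_; map; foldr; concatMap; upTo; allFin; _++_)
open import Data.Bool.ListAction using (all; any)
open import Data.Vec.Base as V using (Vec; []; _∷_; lookup)
open import Data.Maybe.Base using (Maybe; just; nothing; _>>=_; is-nothing; maybe)
open import Data.Sum.Base using (_⊎_; inj₁; inj₂)
open import Data.Product.Base using (_×_; _,_)

countB : {A : Set} → (A → Bool) → List A → ℕ
countB p []       = 0
countB p (x ∷ xs) = if p x then suc (countB p xs) else countB p xs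

allVec : {A : Set} → List A → (m : ℕ) → List (Vec A m)
allVec xs zero    = [] ∷ []
allVec xs (suc m) = concatMap (λ x → map (x ∷_) (allVec xs m)) xs

-- Polynomials in x with ℕ coefficients, as coefficient lists
-- (constant term first); `coeff p m` is the coefficient of x^m.

Poly : Set
Poly = List ℕ

_⊕_ : Poly → Poly → Poly
[]      ⊕ q       = q
(a ∷ p) ⊕ []      = a ∷ p
(a ∷ p) ⊕ (b ∷ q) = (a + b) ∷ (p ⊕ q)

scale : ℕ → Poly → Poly
scale c = map (c *_)

mulXplus : ℕ → Poly → Poly
mulXplus a p = (0 ∷ p) ⊕ scale a p

coeff : Poly → ℕ → ℕ
coeff []      _       = 0
coeff (a ∷ p) zero    = a
coeff (a ∷ p) (suc m) = coeff p m

rising : ℕ → Poly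
rising zero    = 1 ∷ []
rising (suc j) = mulXplus (suc j) (rising j)

S : ℕ → ℕ → ℕ
S zero    zero    = 1
S zero    (suc k) = 0
S (suc n) zero    = 0
S (suc n) (suc k) = suc k * S n (suc k) + S n k

Bhat : ℕ → ℕ → Poly
Bhat n k = foldr _⊕_ []
  (map (λ j → scale ((j !) * S (suc n) (suc j) * S (suc k) (suc j)) (rising j))
       (upTo (suc (n ⊓ k))))

-- Vertices: inj₁ i = i^r (i ≤ n), inj₂ j = j^b (j ≤ k).
-- A pair of rooted trees on these vertices with roots 0^r, 0^b is encoded
-- by its parent map: every non-root vertex has a parent.  Since children of
-- red vertices are blue and vice versa, the parent of i^r (i ≥ 1) is blue and
-- the parent of j^b (j ≥ 1) is red:
--   parR[i] = parent of (i+1)^r ,  parB[j] = parent of (j+1)^b.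

Vtx : ℕ → ℕ → Set
Vtx n k = Fin (suc n) ⊎ Fin (suc k)

ParentData : ℕ → ℕ → Set
ParentData n k = Vec (Fin (suc k)) n × Vec (Fin (suc n)) k

parent : ∀ {n k} → ParentData n k → Vtx n k → Maybe (Vtx n k)
parent (pr , pb) (inj₁ zero)    = nothing
parent (pr , pb) (inj₁ (suc i)) = just (inj₂ (lookup pr i))
parent (pr , pb) (inj₂ zero)    = nothing
parent (pr , pb) (inj₂ (suc j)) = just (inj₁ (lookup pb j))

ancestor : ∀ {n k} → ParentData n k → ℕ → Vtx n k → Maybe (Vtx n k)
ancestor t zero    v = just v
ancestor t (suc d) v = ancestor t d v >>= parent t

allVtx : ∀ n k → List (Vtx n k)
allVtx n k = map inj₁ (allFin (suc n)) ++ map inj₂ (allFin (suc k))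

nV : ℕ → ℕ → ℕ
nV n k = suc n + suc k

-- the parent map has no cycles, i.e. it really describes two rooted trees
-- (every vertex reaches 0^r or 0^b, which have no parent)
isForest : ∀ {n k} → ParentData n k → Bool
isForest {n} {k} t = all (λ v → is-nothing (ancestor t (nV n k) v)) (allVtx n k)

-- u is an ancestor of v: if u and v have the same colour then u < v
-- (i.e. every same-coloured descendant v of u is larger than u)
ancOK : ∀ {n k} → Vtx n k → Vtx n k → Bool
ancOK (inj₁ a) (inj₁ b) = toℕ a <ᵇ toℕ b
ancOK (inj₂ a) (inj₂ b) = toℕ a <ᵇ toℕ b
ancOK _        _        = true

descOK : ∀ {n k} → ParentData n k → Bool
descOK {n} {k} t =
  all (λ v → all (λ d → maybe (λ u → ancOK u v) true (ancestor t (suc d) v))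
                 (upTo (nV n k)))
      (allVtx n k)

isDAT : ∀ {n k} → ParentData n k → Bool
isDAT t = isForest t ∧ descOK t

allParentData : ∀ n k → List (ParentData n k)
allParentData n k =
  concatMap (λ pr → map (pr ,_) (allVec (allFin (suc n)) k))
            (allVec (allFin (suc k)) n)

_≡ᶠ_ : ∀ {m} → Fin m → Fin m → Bool
a ≡ᶠ b = toℕ a ≡ᵇ toℕ b

-- w^ch: number of children of 0^r that are not leaves.
-- Children of 0^r are the (j+1)^b with parB[j] = 0; such a vertex is not a
-- leaf iff some (i+1)^r has parent (j+1)^b.
wch : ∀ {n k} → ParentData n k → ℕ
wch {n} {k} (pr , pb) =
  countB (λ j → (lookup pb j ≡ᶠ zero) ∧ any (λ i → lookup pr i ≡ᶠ suc j) (allFin n))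
         (allFin k)

treeCoeff : ℕ → ℕ → ℕ → ℕ
treeCoeff n k m = countB (λ t → isDAT t ∧ (wch t ≡ᵇ m)) (allParentData n k)

-- A filling of the (n+1)×(k+1) rectangle: rows indexed 0..n from top to
-- bottom (row n is the bottom row), columns 0..k from left to right
-- (column 0 is the leftmost column).

data Cell : Set where
  empty larrow darrow : Cell

isL isD isE : Cell → Bool
isL larrow = true
isL _      = false
isD darrow = true
isD _      = false
isE empty  = true
isE _      = false

Grid : ℕ → ℕ → Set
Grid n k = Vec (Vec Cell (suc k)) (suc n)

cell : ∀ {n k} → Grid n k → Fin (suc n) → Fin (suc k) → Cell
cell g r c = lookup (lookup g r) c

isPAT : ∀ {n k} → Grid n k → Bool
isPAT {n} {k} g = rowsOK ∧ colsOK ∧ pointedOK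
  where
  rowsOK = all (λ r → countB (λ c → isL (cell g r c)) (allFin (suc k))
                        ≡ᵇ (if toℕ r ≡ᵇ n then 0 else 1))
               (allFin (suc n))
  colsOK = all (λ c → countB (λ r → isD (cell g r c)) (allFin (suc n))
                        ≡ᵇ (if toℕ c ≡ᵇ 0 then 0 else 1))
               (allFin (suc k))
  pointedOK = all (λ r → all (λ c →
      (not (isL (cell g r c)) ∨
         all (λ c' → not (toℕ c' <ᵇ toℕ c) ∨ isE (cell g r c')) (allFin (suc k)))
    ∧ (not (isD (cell g r c)) ∨
         all (λ r' → not (toℕ r <ᵇ toℕ r') ∨ isE (cell g r' c)) (allFin (suc n))))
      (allFin (suc k))) (allFin (suc n))

wL : ∀ {n k} → Grid n k → ℕ
wL {n} {k} g =
  countB (λ c → any (λ r → isL (cell g r c)) (allFin (suc n)) ∧ isD (cell g (fromℕ n) c))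
         (allFin (suc k))

allGrids : ∀ n k → List (Grid n k)
allGrids n k = allVec (allVec (empty ∷ larrow ∷ darrow ∷ []) (suc k)) (suc n)

tabCoeff : ℕ → ℕ → ℕ → ℕ
tabCoeff n k m = countB (λ g → isPAT g ∧ (wL g ≡ᵇ m)) (allGrids n k)

{-# OPTIONS --safe #-}
-- A pair of alternating trees is a double alternative tree iff every non-root vertex is
-- larger than its grandparent, and such pairs correspond bijectively to packed alternative tableaux
-- (red vertices become rows, blue vertices columns, parent edges arrows), with w^ch matching w^←.
-- For the generating function, delete the blue vertex 1 and attach its red children to 0^b. Refined
-- by the number of red children of 0^b, this is a transfer recursion in k whose matrix T has entries
-- of degree at most one in x, so the count is a row sum of T^k. Splitting T^k at its first factor
-- instead of its last gives a recursion that also determines the coefficients of B̂, as the Stirling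
-- recurrence and two binomial sums of Stirling numbers show.
module Submission where

open import Algebra.Bundles using (CommutativeMonoid)
open import Data.Bool.Base using (Bool; true; false; _∧_; _∨_; not; if_then_else_)
open import Data.Bool.ListAction using (all; any)
open import Data.Bool.Properties using (∧-assoc; ∧-comm; ∧-identityʳ; ∧-zeroʳ; ∧-commutativeMonoid; T-≡)
open import Algebra.Properties.CommutativeSemigroup (CommutativeMonoid.commutativeSemigroup ∧-commutativeMonoid)
  using (interchange)
open import Data.Empty using (⊥; ⊥-elim)
open import Data.Fin.Base using (Fin; zero; suc; toℕ; fromℕ; opposite)
open import Data.Fin.Properties using (toℕ-injective; toℕ<n; toℕ-fromℕ; opposite-involutive; opposite-prop)
  renaming (_≟_ to _≟ᶠ_)
open import Data.List.Base using (List; []; _∷_; map; foldr; concatMap; concat; upTo; applyUpTo; allFin; tabulate; _++_)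
open import Data.Maybe.Base using (just; nothing; is-nothing; maybe)
open import Data.Nat.Base
open import Data.Nat.Combinatorics using (_C_; nCn≡1; k>n⇒nCk≡0; nCk+nC[k+1]≡[n+1]C[k+1])
open import Data.Nat.Properties
open import Data.Nat.Tactic.RingSolver using (solve-∀)
open import Data.Product.Base using (_×_; _,_; proj₁; proj₂; Σ)
open import Data.Sum.Base using (_⊎_; inj₁; inj₂)
open import Data.Unit.Base using (⊤; tt)
open import Data.Vec.Base as V using (Vec; []; _∷_; lookup)
open import Data.Vec.Properties using (≡-dec; lookup-map; lookup∘tabulate; tabulate∘lookup; tabulate-cong)
open import Function.Base using (_∘_; id)
open import Function.Bundles using (Equivalence)
open import Relation.Binary.Definitions using (DecidableEquality; tri<; tri≈; tri>)
open import Relation.Binary.PropositionalEquality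
open import Relation.Nullary using (yes; no; does; map′; _×-dec_)
open import Defs

⟦_⟧ : Bool → ℕ
⟦ true ⟧ = 1
⟦ false ⟧ = 0

⟦∧⟧ : ∀ a b → ⟦ a ∧ b ⟧ ≡ ⟦ a ⟧ * ⟦ b ⟧
⟦∧⟧ true b = sym (+-identityʳ _)
⟦∧⟧ false b = refl

bool-ext : ∀ {a b : Bool} → (a ≡ true → b ≡ true) → (b ≡ true → a ≡ true) → a ≡ b
bool-ext {true} {true} f g = refl
bool-ext {true} {false} f g = sym (f refl)
bool-ext {false} {true} f g = g refl
bool-ext {false} {false} f g = refl

∧-elim : ∀ {a b : Bool} → a ∧ b ≡ true → (a ≡ true) × (b ≡ true)
∧-elim {true} {true} e = refl , refl

∧-intro : ∀ {a b : Bool} → a ≡ true → b ≡ true → a ∧ b ≡ true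
∧-intro refl refl = refl

impl-elim : ∀ {a b : Bool} → (not a ∨ b) ≡ true → a ≡ true → b ≡ true
impl-elim {true} {b} e refl = e

impl-intro : ∀ {a b : Bool} → (a ≡ true → b ≡ true) → (not a ∨ b) ≡ true
impl-intro {true} f = f refl
impl-intro {false} f = refl

false-by : ∀ {b : Bool} → (b ≡ true → ⊥) → b ≡ false
false-by {true} f = ⊥-elim (f refl)
false-by {false} f = refl

≡ᵇ≡true⇒≡ : ∀ m n → (m ≡ᵇ n) ≡ true → m ≡ n
≡ᵇ≡true⇒≡ m n e = ≡ᵇ⇒≡ m n (Equivalence.from T-≡ e)

≡⇒≡ᵇ≡true : ∀ m n → m ≡ n → (m ≡ᵇ n) ≡ true
≡⇒≡ᵇ≡true m n e = Equivalence.to T-≡ (≡⇒≡ᵇ m n e)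

≡ᵇ-refl : ∀ n → (n ≡ᵇ n) ≡ true
≡ᵇ-refl n = ≡⇒≡ᵇ≡true n n refl

≢⇒≡ᵇ≡false : ∀ m n → m ≢ n → (m ≡ᵇ n) ≡ false
≢⇒≡ᵇ≡false m n m≢n = false-by (m≢n ∘ ≡ᵇ≡true⇒≡ m n)

≡ᵇ-sym : ∀ m n → (m ≡ᵇ n) ≡ (n ≡ᵇ m)
≡ᵇ-sym m n = bool-ext (λ e → ≡⇒≡ᵇ≡true n m (sym (≡ᵇ≡true⇒≡ m n e)))
                      (λ e → ≡⇒≡ᵇ≡true m n (sym (≡ᵇ≡true⇒≡ n m e)))

<ᵇ≡true⇒< : ∀ m n → (m <ᵇ n) ≡ true → m < n
<ᵇ≡true⇒< m n e = <ᵇ⇒< m n (Equivalence.from T-≡ e)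

<⇒<ᵇ≡true : ∀ m n → m < n → (m <ᵇ n) ≡ true
<⇒<ᵇ≡true m n m<n = Equivalence.to T-≡ (<⇒<ᵇ m<n)

≥⇒<ᵇ≡false : ∀ m n → n ≤ m → (m <ᵇ n) ≡ false
≥⇒<ᵇ≡false m n n≤m = false-by (≤⇒≯ n≤m ∘ <ᵇ≡true⇒< m n)

≤ᵇ≡true⇒≤ : ∀ m n → (m ≤ᵇ n) ≡ true → m ≤ n
≤ᵇ≡true⇒≤ m n e = ≤ᵇ⇒≤ m n (Equivalence.from T-≡ e)

≤⇒≤ᵇ≡true : ∀ m n → m ≤ n → (m ≤ᵇ n) ≡ true
≤⇒≤ᵇ≡true m n m≤n = Equivalence.to T-≡ (≤⇒≤ᵇ m≤n)

>⇒≤ᵇ≡false : ∀ m n → n < m → (m ≤ᵇ n) ≡ false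
>⇒≤ᵇ≡false m n n<m = false-by (<⇒≱ n<m ∘ ≤ᵇ≡true⇒≤ m n)

≤ᵇ≡<ᵇ-suc : ∀ m n → (m ≤ᵇ n) ≡ (m <ᵇ suc n)
≤ᵇ≡<ᵇ-suc zero n = refl
≤ᵇ≡<ᵇ-suc (suc m) n = refl

≡ᵇ-+ʳ : ∀ m n → (m ≡ᵇ m + n) ≡ (n ≡ᵇ 0)
≡ᵇ-+ʳ zero n = ≡ᵇ-sym 0 n
≡ᵇ-+ʳ (suc m) n = ≡ᵇ-+ʳ m n

⟦≡ᵇ⟧-subst : ∀ m n (F : ℕ → ℕ) → F m * ⟦ m ≡ᵇ n ⟧ ≡ F n * ⟦ m ≡ᵇ n ⟧
⟦≡ᵇ⟧-subst m n F with m ≡ᵇ n in eq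
... | true rewrite ≡ᵇ≡true⇒≡ m n eq = refl
... | false = trans (*-zeroʳ (F m)) (sym (*-zeroʳ (F n)))

≡ᶠ-sound : ∀ {m} (a b : Fin m) → (a ≡ᶠ b) ≡ true → a ≡ b
≡ᶠ-sound a b e = toℕ-injective (≡ᵇ≡true⇒≡ (toℕ a) (toℕ b) e)

≡ᶠ-refl : ∀ {m} (a : Fin m) → (a ≡ᶠ a) ≡ true
≡ᶠ-refl a = ≡ᵇ-refl (toℕ a)

≡ᶠ-sym : ∀ {m} (a b : Fin m) → (a ≡ᶠ b) ≡ (b ≡ᶠ a)
≡ᶠ-sym a b = ≡ᵇ-sym (toℕ a) (toℕ b)

sumL : {A : Set} → (A → ℕ) → List A → ℕ
sumL f [] = 0
sumL f (x ∷ xs) = f x + sumL f xs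

countB≡sumL : {A : Set} (p : A → Bool) (xs : List A) → countB p xs ≡ sumL (λ x → ⟦ p x ⟧) xs
countB≡sumL p [] = refl
countB≡sumL p (x ∷ xs) with p x
... | true = cong suc (countB≡sumL p xs)
... | false = countB≡sumL p xs

countB-cong : {A : Set} {p q : A → Bool} (xs : List A) → (∀ x → p x ≡ q x) → countB p xs ≡ countB q xs
countB-cong [] e = refl
countB-cong (x ∷ xs) e rewrite e x = cong (λ c → if _ then suc c else c) (countB-cong xs e)

sumL-cong : {A : Set} {f g : A → ℕ} (xs : List A) → (∀ x → f x ≡ g x) → sumL f xs ≡ sumL g xs
sumL-cong [] e = refl
sumL-cong (x ∷ xs) e = cong₂ _+_ (e x) (sumL-cong xs e)

sumL-++ : {A : Set} (f : A → ℕ) (xs ys : List A) → sumL f (xs ++ ys) ≡ sumL f xs + sumL f ys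
sumL-++ f [] ys = refl
sumL-++ f (x ∷ xs) ys = trans (cong (f x +_) (sumL-++ f xs ys)) (sym (+-assoc (f x) _ _))

sumL-map : {A B : Set} (f : B → ℕ) (g : A → B) (xs : List A) → sumL f (map g xs) ≡ sumL (f ∘ g) xs
sumL-map f g [] = refl
sumL-map f g (x ∷ xs) = cong (f (g x) +_) (sumL-map f g xs)

sumL-concatMap : {A B : Set} (f : B → ℕ) (g : A → List B) (xs : List A) →
  sumL f (concatMap g xs) ≡ sumL (λ x → sumL f (g x)) xs
sumL-concatMap f g [] = refl
sumL-concatMap f g (x ∷ xs) = trans (sumL-++ f (g x) (concat (map g xs))) (cong (sumL f (g x) +_) (sumL-concatMap f g xs))

sumL-+ : {A : Set} (f g : A → ℕ) (xs : List A) → sumL (λ x → f x + g x) xs ≡ sumL f xs + sumL g xs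
sumL-+ f g [] = refl
sumL-+ f g (x ∷ xs) rewrite sumL-+ f g xs = ring (f x) (g x) (sumL f xs) (sumL g xs) where
  ring : ∀ a b c d → a + b + (c + d) ≡ a + c + (b + d)
  ring = solve-∀

sumL-* : {A : Set} (c : ℕ) (f : A → ℕ) (xs : List A) → sumL (λ x → c * f x) xs ≡ c * sumL f xs
sumL-* c f [] = sym (*-zeroʳ c)
sumL-* c f (x ∷ xs) = trans (cong (c * f x +_) (sumL-* c f xs)) (sym (*-distribˡ-+ c (f x) _))

sumL-zero : {A : Set} (xs : List A) → sumL (λ _ → 0) xs ≡ 0
sumL-zero [] = refl
sumL-zero (x ∷ xs) = sumL-zero xs

sumL-swap : {A B : Set} (f : A → B → ℕ) (xs : List A) (ys : List B) →
  sumL (λ x → sumL (f x) ys) xs ≡ sumL (λ y → sumL (λ x → f x y) xs) ys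
sumL-swap f [] ys = sym (sumL-zero ys)
sumL-swap f (x ∷ xs) ys = trans (cong (sumL (f x) ys +_) (sumL-swap f xs ys)) (sym (sumL-+ (f x) (λ y → sumL (λ x → f x y) xs) ys))

sumN : ℕ → (ℕ → ℕ) → ℕ
sumN zero f = 0
sumN (suc n) f = f zero + sumN n (f ∘ suc)

sumF : (n : ℕ) → (Fin n → ℕ) → ℕ
sumF zero f = 0
sumF (suc n) f = f zero + sumF n (f ∘ suc)

sumL-tabulate : {A : Set} (n : ℕ) (f : A → ℕ) (g : Fin n → A) → sumL f (tabulate g) ≡ sumF n (f ∘ g)
sumL-tabulate zero f g = refl
sumL-tabulate (suc n) f g = cong (f (g zero) +_) (sumL-tabulate n f (g ∘ suc))

sumL-allFin : (n : ℕ) (f : Fin n → ℕ) → sumL f (allFin n) ≡ sumF n f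
sumL-allFin n f = sumL-tabulate n f id

sumL-applyUpTo : (n : ℕ) (f : ℕ → ℕ) (g : ℕ → ℕ) → sumL f (applyUpTo g n) ≡ sumN n (f ∘ g)
sumL-applyUpTo zero f g = refl
sumL-applyUpTo (suc n) f g = cong (f (g zero) +_) (sumL-applyUpTo n f (g ∘ suc))

sumL-upTo : (n : ℕ) (f : ℕ → ℕ) → sumL f (upTo n) ≡ sumN n f
sumL-upTo n f = sumL-applyUpTo n f id

sumN-cong : (n : ℕ) {f g : ℕ → ℕ} → (∀ i → i < n → f i ≡ g i) → sumN n f ≡ sumN n g
sumN-cong zero e = refl
sumN-cong (suc n) e = cong₂ _+_ (e zero (s≤s z≤n)) (sumN-cong n (λ i lt → e (suc i) (s≤s lt)))

sumN-+ : (n : ℕ) (f g : ℕ → ℕ) → sumN n (λ i → f i + g i) ≡ sumN n f + sumN n g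
sumN-+ zero f g = refl
sumN-+ (suc n) f g rewrite sumN-+ n (f ∘ suc) (g ∘ suc) = ring (f 0) (g 0) (sumN n (f ∘ suc)) (sumN n (g ∘ suc)) where
  ring : ∀ a b c d → a + b + (c + d) ≡ a + c + (b + d)
  ring = solve-∀

sumN-* : (n : ℕ) (c : ℕ) (f : ℕ → ℕ) → sumN n (λ i → c * f i) ≡ c * sumN n f
sumN-* zero c f = sym (*-zeroʳ c)
sumN-* (suc n) c f = trans (cong (c * f 0 +_) (sumN-* n c (f ∘ suc))) (sym (*-distribˡ-+ c (f 0) _))

sumN-zero : (n : ℕ) (f : ℕ → ℕ) → (∀ i → i < n → f i ≡ 0) → sumN n f ≡ 0
sumN-zero zero f e = refl
sumN-zero (suc n) f e = cong₂ _+_ (e 0 (s≤s z≤n)) (sumN-zero n (f ∘ suc) (λ i lt → e (suc i) (s≤s lt)))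

sumN-snoc : (n : ℕ) (f : ℕ → ℕ) → sumN (suc n) f ≡ sumN n f + f n
sumN-snoc zero f = +-comm (f 0) 0
sumN-snoc (suc n) f = trans (cong (f 0 +_) (sumN-snoc n (f ∘ suc))) (sym (+-assoc (f 0) _ _))

sumN-swap : (n m : ℕ) (f : ℕ → ℕ → ℕ) → sumN n (λ i → sumN m (f i)) ≡ sumN m (λ j → sumN n (λ i → f i j))
sumN-swap zero m f = sym (sumN-zero m _ (λ _ _ → refl))
sumN-swap (suc n) m f = trans (cong (sumN m (f 0) +_) (sumN-swap n m (f ∘ suc))) (sym (sumN-+ m (f 0) _))

sumN-pad : (n d : ℕ) (f : ℕ → ℕ) → (∀ i → n ≤ i → f i ≡ 0) → sumN (n + d) f ≡ sumN n f
sumN-pad zero d f e = sumN-zero d f (λ i _ → e i z≤n)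
sumN-pad (suc n) d f e = cong (f 0 +_) (sumN-pad n d (f ∘ suc) (λ i le → e (suc i) (s≤s le)))

sumN-extend : (n m : ℕ) (f : ℕ → ℕ) → n ≤ m → (∀ i → n ≤ i → f i ≡ 0) → sumN m f ≡ sumN n f
sumN-extend n m f n≤m e =
  trans (cong (λ z → sumN z f) (trans (sym (m∸n+n≡m n≤m)) (+-comm (m ∸ n) n))) (sumN-pad n (m ∸ n) f e)

sumN-indicator : ∀ N j (g : ℕ → ℕ) → (N ≤ j → g j ≡ 0) → sumN N (λ i → ⟦ i ≡ᵇ j ⟧ * g i) ≡ g j
sumN-indicator zero j g out = sym (out z≤n)
sumN-indicator (suc N) zero g out =
  trans (cong (1 * g 0 +_) (sumN-zero N _ (λ _ _ → refl))) (trans (+-identityʳ _) (*-identityˡ _))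
sumN-indicator (suc N) (suc j) g out = sumN-indicator N j (g ∘ suc) (out ∘ s≤s)

sumL-sumN-swap : ∀ {A : Set} N (h : A → ℕ → ℕ) (xs : List A) → sumL (λ x → sumN N (h x)) xs ≡ sumN N (λ r → sumL (λ x → h x r) xs)
sumL-sumN-swap N h [] = sym (sumN-zero N (λ _ → 0) (λ _ _ → refl))
sumL-sumN-swap N h (x ∷ xs) = trans (cong (sumN N (h x) +_) (sumL-sumN-swap N h xs)) (sym (sumN-+ N (h x) _))

sumL-byValue : ∀ {A : Set} (xs : List A) (g : A → ℕ) N (f : A → ℕ) → (∀ x → g x < N) →
  sumL f xs ≡ sumN N (λ r → sumL (λ x → ⟦ g x ≡ᵇ r ⟧ * f x) xs)
sumL-byValue xs g N f bd = trans (sumL-cong xs as-indicator-sum) (sumL-sumN-swap N (λ x r → ⟦ g x ≡ᵇ r ⟧ * f x) xs) where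
  as-indicator-sum : ∀ x → f x ≡ sumN N (λ r → ⟦ g x ≡ᵇ r ⟧ * f x)
  as-indicator-sum x = sym (trans (sumN-cong N (λ r _ → cong (λ b → ⟦ b ⟧ * f x) (≡ᵇ-sym (g x) r)))
                    (sumN-indicator N (g x) (λ _ → f x) (λ N≤gx → ⊥-elim (<⇒≱ (bd x) N≤gx))))

sumF-cong : ∀ n {p q : Fin n → ℕ} → (∀ i → p i ≡ q i) → sumF n p ≡ sumF n q
sumF-cong zero e = refl
sumF-cong (suc n) e = cong₂ _+_ (e zero) (sumF-cong n (e ∘ suc))

sumF-* : ∀ n c (f : Fin n → ℕ) → sumF n (λ i → c * f i) ≡ c * sumF n f
sumF-* zero c f = sym (*-zeroʳ c)
sumF-* (suc n) c f = trans (cong (c * f zero +_) (sumF-* n c (f ∘ suc))) (sym (*-distribˡ-+ c _ _))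

sumF-zero : ∀ n (f : Fin n → ℕ) → (∀ i → f i ≡ 0) → sumF n f ≡ 0
sumF-zero zero f e = refl
sumF-zero (suc n) f e = cong₂ _+_ (e zero) (sumF-zero n (f ∘ suc) (e ∘ suc))

sumF-pos : ∀ m (p : Fin m → Bool) a → p a ≡ true → 1 ≤ sumF m (λ c → ⟦ p c ⟧)
sumF-pos (suc m) p zero e rewrite e = s≤s z≤n
sumF-pos (suc m) p (suc a) e = ≤-trans (sumF-pos m (p ∘ suc) a e) (m≤n+m _ ⟦ p zero ⟧)

sumF-≡ᶠ : ∀ m (a : Fin m) → sumF m (λ x → ⟦ x ≡ᶠ a ⟧) ≡ 1
sumF-≡ᶠ (suc m) zero = cong suc (sumF-zero m _ (λ x → refl))
sumF-≡ᶠ (suc m) (suc a) = sumF-≡ᶠ m a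

allF : (n : ℕ) → (Fin n → Bool) → Bool
allF zero p = true
allF (suc n) p = p zero ∧ allF n (p ∘ suc)

anyF : (n : ℕ) → (Fin n → Bool) → Bool
anyF zero p = false
anyF (suc n) p = p zero ∨ anyF n (p ∘ suc)

all-tabulate : ∀ {A : Set} n (p : A → Bool) (f : Fin n → A) → all p (tabulate f) ≡ allF n (p ∘ f)
all-tabulate zero p f = refl
all-tabulate (suc n) p f = cong (p (f zero) ∧_) (all-tabulate n p (f ∘ suc))

any-tabulate : ∀ {A : Set} n (p : A → Bool) (f : Fin n → A) → any p (tabulate f) ≡ anyF n (p ∘ f)
any-tabulate zero p f = refl
any-tabulate (suc n) p f = cong (p (f zero) ∨_) (any-tabulate n p (f ∘ suc))

countB-tabulate : ∀ {A : Set} n (p : A → Bool) (f : Fin n → A) → countB p (tabulate f) ≡ sumF n (λ i → ⟦ p (f i) ⟧)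
countB-tabulate n p f = trans (countB≡sumL p (tabulate f)) (sumL-tabulate n (λ x → ⟦ p x ⟧) f)

allF-cong : ∀ n {p q : Fin n → Bool} → (∀ i → p i ≡ q i) → allF n p ≡ allF n q
allF-cong zero e = refl
allF-cong (suc n) e = cong₂ _∧_ (e zero) (allF-cong n (e ∘ suc))

anyF-cong : ∀ n {p q : Fin n → Bool} → (∀ i → p i ≡ q i) → anyF n p ≡ anyF n q
anyF-cong zero e = refl
anyF-cong (suc n) e = cong₂ _∨_ (e zero) (anyF-cong n (e ∘ suc))

allF-∧ : ∀ n (p q : Fin n → Bool) → allF n (λ i → p i ∧ q i) ≡ allF n p ∧ allF n q
allF-∧ zero p q = refl
allF-∧ (suc n) p q = trans (cong ((p zero ∧ q zero) ∧_) (allF-∧ n (p ∘ suc) (q ∘ suc))) (interchange (p zero) (q zero) _ _)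

allF-true : ∀ n (p : Fin n → Bool) → (∀ i → p i ≡ true) → allF n p ≡ true
allF-true zero p e = refl
allF-true (suc n) p e rewrite e zero = allF-true n (p ∘ suc) (e ∘ suc)

allF-elim : ∀ n (p : Fin n → Bool) → allF n p ≡ true → ∀ i → p i ≡ true
allF-elim (suc n) p e zero with p zero | e
... | true | _ = refl
allF-elim (suc n) p e (suc i) with p zero | e
... | true | e' = allF-elim n (p ∘ suc) e' i

anyF-false : ∀ n (p : Fin n → Bool) → (∀ i → p i ≡ false) → anyF n p ≡ false
anyF-false zero p e = refl
anyF-false (suc n) p e rewrite e zero = anyF-false n (p ∘ suc) (e ∘ suc)

anyF-intro : ∀ n (p : Fin n → Bool) i → p i ≡ true → anyF n p ≡ true
anyF-intro (suc n) p zero e rewrite e = refl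
anyF-intro (suc n) p (suc i) e with p zero
... | true = refl
... | false = anyF-intro n (p ∘ suc) i e

anyF-elim : ∀ n (p : Fin n → Bool) → anyF n p ≡ true → Σ (Fin n) (λ i → p i ≡ true)
anyF-elim (suc n) p e with p zero in eq
... | true = zero , eq
... | false with anyF-elim n (p ∘ suc) e
... | i , e' = suc i , e'

all-intro : ∀ {A : Set} (p : A → Bool) (xs : List A) → (∀ x → p x ≡ true) → all p xs ≡ true
all-intro p [] e = refl
all-intro p (x ∷ xs) e rewrite e x = all-intro p xs e

all-++ : ∀ {A : Set} (p : A → Bool) (xs ys : List A) → all p (xs ++ ys) ≡ all p xs ∧ all p ys
all-++ p [] ys = refl
all-++ p (x ∷ xs) ys rewrite all-++ p xs ys with p x
... | true = refl
... | false = refl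

all-map : ∀ {A B : Set} (p : B → Bool) (f : A → B) (xs : List A) → all p (map f xs) ≡ all (p ∘ f) xs
all-map p f [] = refl
all-map p f (x ∷ xs) = cong (p (f x) ∧_) (all-map p f xs)

all-applyUpTo : ∀ (p : ℕ → Bool) (f : ℕ → ℕ) N d → all p (applyUpTo f N) ≡ true → d < N → p (f d) ≡ true
all-applyUpTo p f (suc N) zero e lt with p (f 0) | e
... | true | _ = refl
all-applyUpTo p f (suc N) (suc d) e (s≤s lt) with p (f 0) | e
... | true | e' = all-applyUpTo p (f ∘ suc) N d e' lt

firstTrue : ∀ {m} → (Fin (suc m) → Bool) → Fin (suc m)
firstTrue {zero} p = zero
firstTrue {suc m} p = if p zero then zero else suc (firstTrue (p ∘ suc))

firstTrue-unique : ∀ {m} (p : Fin (suc m) → Bool) c → p c ≡ true → (∀ c' → p c' ≡ true → c' ≡ c) → firstTrue p ≡ c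
firstTrue-unique {zero} p zero pc u = refl
firstTrue-unique {suc m} p c pc u with p zero in e0
... | true = u zero e0
firstTrue-unique {suc m} p zero pc u | false = ⊥-elim (bot (trans (sym e0) pc)) where
  bot : false ≡ true → ⊥
  bot ()
firstTrue-unique {suc m} p (suc c) pc u | false = cong suc (firstTrue-unique (p ∘ suc) c pc (λ c' e → suc-inj (u (suc c') e))) where
  suc-inj : ∀ {m} {a b : Fin m} → Fin.suc a ≡ suc b → a ≡ b
  suc-inj refl = refl

count1-unique : ∀ m (p : Fin m → Bool) → sumF m (λ c → ⟦ p c ⟧) ≡ 1 → ∀ a b → p a ≡ true → p b ≡ true → a ≡ b
count1-unique (suc m) p e zero zero pa pb = refl
count1-unique (suc m) p e zero (suc b) pa pb rewrite pa = ⊥-elim (<⇒≱ (s≤s (sumF-pos m (p ∘ suc) b pb)) (≤-reflexive e))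
count1-unique (suc m) p e (suc a) zero pa pb rewrite pb = ⊥-elim (<⇒≱ (s≤s (sumF-pos m (p ∘ suc) a pa)) (≤-reflexive e))
count1-unique (suc m) p e (suc a) (suc b) pa pb with p zero
... | true = ⊥-elim (<⇒≱ (s≤s (sumF-pos m (p ∘ suc) a pa)) (≤-reflexive e))
... | false = cong suc (count1-unique m (p ∘ suc) e a b pa pb)

count0⇒false : ∀ m (p : Fin m → Bool) → sumF m (λ c → ⟦ p c ⟧) ≡ 0 → ∀ a → p a ≡ false
count0⇒false m p e a with p a in pa
... | false = refl
... | true = ⊥-elim (<⇒≱ (sumF-pos m p a pa) (≤-reflexive e))

count1⇒∃ : ∀ m (p : Fin m → Bool) → sumF m (λ c → ⟦ p c ⟧) ≡ 1 → Σ (Fin m) (λ a → p a ≡ true)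
count1⇒∃ (suc m) p e with p zero in e0
... | true = zero , e0
... | false with count1⇒∃ m (p ∘ suc) e
... | a , pa = suc a , pa

count1⇒firstTrue : ∀ m (p : Fin (suc m) → Bool) → sumF (suc m) (λ c → ⟦ p c ⟧) ≡ 1 → ∀ c → p c ≡ (firstTrue p ≡ᶠ c)
count1⇒firstTrue m p e c with count1⇒∃ (suc m) p e
... | a , pa = bool-ext
  (λ pc → subst (λ z → (firstTrue p ≡ᶠ z) ≡ true) (firstTrue≡ c pc) (≡ᶠ-refl (firstTrue p)))
  (λ ef → subst (λ z → p z ≡ true) (trans (sym (firstTrue≡ a pa)) (≡ᶠ-sound (firstTrue p) c ef)) pa)
  where
  firstTrue≡ : ∀ b → p b ≡ true → firstTrue p ≡ b
  firstTrue≡ b pb = firstTrue-unique p b pb (λ c' pc' → count1-unique (suc m) p e c' b pc' pb)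

Enumerates : {A : Set} → DecidableEquality A → List A → Set
Enumerates _≟_ xs = ∀ a → sumL (λ x → ⟦ does (x ≟ a) ⟧) xs ≡ 1

_×-≟_ : {A B : Set} → DecidableEquality A → DecidableEquality B → DecidableEquality (A × B)
(_≟A_ ×-≟ _≟B_) (a , b) (a′ , b′) =
  map′ (λ (p , q) → cong₂ _,_ p q) (λ { refl → refl , refl }) ((a ≟A a′) ×-dec (b ≟B b′))

sumL-allVec-suc : ∀ {A : Set} (xs : List A) k (g : Vec A (suc k) → ℕ) →
  sumL g (allVec xs (suc k)) ≡ sumL (λ x → sumL (λ v → g (x ∷ v)) (allVec xs k)) xs
sumL-allVec-suc xs k g = trans (sumL-concatMap g (λ x → map (x ∷_) (allVec xs k)) xs)
  (sumL-cong xs (λ x → sumL-map g (x ∷_) (allVec xs k)))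

sumL-pairs : ∀ {A B : Set} (f : A × B → ℕ) (xs : List A) (ys : List B) →
  sumL f (concatMap (λ x → map (x ,_) ys) xs) ≡ sumL (λ x → sumL (λ y → f (x , y)) ys) xs
sumL-pairs f xs ys = trans (sumL-concatMap f (λ x → map (x ,_) ys) xs)
  (sumL-cong xs (λ x → sumL-map f (x ,_) ys))

sumL-scaled-indicator : ∀ {A : Set} {_≟_ : DecidableEquality A} {xs} → Enumerates _≟_ xs →
  ∀ a c → sumL (λ x → c * ⟦ does (x ≟ a) ⟧) xs ≡ c
sumL-scaled-indicator {_≟_ = _≟_} {xs} enum a c =
  trans (sumL-* c (λ x → ⟦ does (x ≟ a) ⟧) xs) (trans (cong (c *_) (enum a)) (*-identityʳ c))

allFin-enumerates : ∀ m → Enumerates _≟ᶠ_ (allFin m)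
allFin-enumerates m a = trans (sumL-allFin m _) (count m a) where
  count : ∀ m (a : Fin m) → sumF m (λ x → ⟦ does (x ≟ᶠ a) ⟧) ≡ 1
  count (suc m) zero = cong suc (sumF-zero m _ (λ _ → refl))
  count (suc m) (suc a) = count m a

allVec-enumerates : ∀ {A : Set} {_≟_ : DecidableEquality A} {xs} → Enumerates _≟_ xs →
  ∀ m → Enumerates (≡-dec _≟_) (allVec xs m)
allVec-enumerates enum zero [] = refl
allVec-enumerates {_≟_ = _≟_} {xs} enum (suc m) (w ∷ ws) = begin
  sumL (λ v → ⟦ does (≡-dec _≟_ v (w ∷ ws)) ⟧) (allVec xs (suc m))
    ≡⟨ sumL-allVec-suc xs m (λ v → ⟦ does (≡-dec _≟_ v (w ∷ ws)) ⟧) ⟩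
  sumL (λ x → sumL (λ v → ⟦ does (x ≟ w) ∧ does (≡-dec _≟_ v ws) ⟧) (allVec xs m)) xs
    ≡⟨ sumL-cong xs (λ x → trans (sumL-cong (allVec xs m) (λ v → ⟦∧⟧ (does (x ≟ w)) (does (≡-dec _≟_ v ws))))
                                 (sumL-scaled-indicator {_≟_ = ≡-dec _≟_} {allVec xs m} (allVec-enumerates enum m) ws ⟦ does (x ≟ w) ⟧)) ⟩
  sumL (λ x → ⟦ does (x ≟ w) ⟧) xs
    ≡⟨ enum w ⟩
  1 ∎
  where open ≡-Reasoning

pairs-enumerate : ∀ {A B : Set} {_≟A_ : DecidableEquality A} {_≟B_ : DecidableEquality B} {xs ys} →
  Enumerates _≟A_ xs → Enumerates _≟B_ ys → Enumerates (_≟A_ ×-≟ _≟B_) (concatMap (λ x → map (x ,_) ys) xs)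
pairs-enumerate {_≟A_ = _≟A_} {_≟B_} {xs} {ys} enumA enumB (a , b) = begin
  sumL (λ p → ⟦ does ((_≟A_ ×-≟ _≟B_) p (a , b)) ⟧) (concatMap (λ x → map (x ,_) ys) xs)
    ≡⟨ sumL-pairs (λ p → ⟦ does ((_≟A_ ×-≟ _≟B_) p (a , b)) ⟧) xs ys ⟩
  sumL (λ x → sumL (λ y → ⟦ does (x ≟A a) ∧ does (y ≟B b) ⟧) ys) xs
    ≡⟨ sumL-cong xs (λ x → trans (sumL-cong ys (λ y → ⟦∧⟧ (does (x ≟A a)) (does (y ≟B b))))
                                 (sumL-scaled-indicator {_≟_ = _≟B_} {ys} enumB b ⟦ does (x ≟A a) ⟧)) ⟩
  sumL (λ x → ⟦ does (x ≟A a) ⟧) xs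
    ≡⟨ enumA a ⟩
  1 ∎
  where open ≡-Reasoning

-- Double counting: each side counts the pairs (x , y) with P x and x = f y.
countB-bijection : ∀ {A B : Set} {_≟A_ : DecidableEquality A} {_≟B_ : DecidableEquality B} {xs ys} →
  Enumerates _≟A_ xs → Enumerates _≟B_ ys →
  (P : A → Bool) (Q : B → Bool) (f : B → A) (g : A → B) → (∀ y → P (f y) ≡ Q y) →
  (∀ x → P x ≡ true → f (g x) ≡ x) → (∀ y → Q y ≡ true → g (f y) ≡ y) →
  countB P xs ≡ countB Q ys
countB-bijection {_≟A_ = _≟A_} {_≟B_} {xs} {ys} enumA enumB P Q f g P∘f f∘g g∘f = begin
  countB P xs
    ≡⟨ countB≡sumL P xs ⟩
  sumL (λ x → ⟦ P x ⟧) xs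
    ≡⟨ sumL-cong xs (λ x → sym (sumL-over-ys x)) ⟩
  sumL (λ x → sumL (λ y → ⟦ P x ⟧ * ⟦ does (x ≟A f y) ⟧) ys) xs
    ≡⟨ sumL-swap (λ x y → ⟦ P x ⟧ * ⟦ does (x ≟A f y) ⟧) xs ys ⟩
  sumL (λ y → sumL (λ x → ⟦ P x ⟧ * ⟦ does (x ≟A f y) ⟧) xs) ys
    ≡⟨ sumL-cong ys sumL-over-xs ⟩
  sumL (λ y → ⟦ Q y ⟧) ys
    ≡⟨ countB≡sumL Q ys ⟨
  countB Q ys ∎
  where
  open ≡-Reasoning
  x≟fy≡y≟gx : ∀ x y → P x ≡ true → does (x ≟A f y) ≡ does (y ≟B g x)
  x≟fy≡y≟gx x y Px with x ≟A f y | y ≟B g x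
  ... | yes refl | no y≢gfy = ⊥-elim (y≢gfy (sym (g∘f y (trans (sym (P∘f y)) Px))))
  ... | no x≢fgx | yes refl = ⊥-elim (x≢fgx (sym (f∘g x Px)))
  ... | yes _ | yes _ = refl
  ... | no _ | no _ = refl
  sumL-over-ys : ∀ x → sumL (λ y → ⟦ P x ⟧ * ⟦ does (x ≟A f y) ⟧) ys ≡ ⟦ P x ⟧
  sumL-over-ys x with P x in Px
  ... | false = sumL-zero ys
  ... | true = trans (sumL-cong ys (λ y → trans (+-identityʳ _) (cong ⟦_⟧ (x≟fy≡y≟gx x y Px)))) (enumB (g x))
  P≡Q-on-fibre : ∀ y x → ⟦ P x ⟧ * ⟦ does (x ≟A f y) ⟧ ≡ ⟦ Q y ⟧ * ⟦ does (x ≟A f y) ⟧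
  P≡Q-on-fibre y x with x ≟A f y
  ... | yes refl = cong (_* 1) (cong ⟦_⟧ (P∘f y))
  ... | no _ = trans (*-zeroʳ ⟦ P x ⟧) (sym (*-zeroʳ ⟦ Q y ⟧))
  sumL-over-xs : ∀ y → sumL (λ x → ⟦ P x ⟧ * ⟦ does (x ≟A f y) ⟧) xs ≡ ⟦ Q y ⟧
  sumL-over-xs y = trans (sumL-cong xs (P≡Q-on-fibre y)) (sumL-scaled-indicator {_≟_ = _≟A_} {xs} enumA (f y) ⟦ Q y ⟧)

shift : (ℕ → ℕ) → ℕ → ℕ
shift p zero = 0
shift p (suc m) = p m

-- Polynomials in x are handled through their coefficient sequences; mulLin a b p is (a + b x) · p.
mulLin : ℕ → ℕ → (ℕ → ℕ) → ℕ → ℕ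
mulLin a b p m = a * p m + b * shift p m

mulLin-cong : ∀ a b {p q : ℕ → ℕ} → (∀ m → p m ≡ q m) → ∀ m → mulLin a b p m ≡ mulLin a b q m
mulLin-cong a b e zero = cong (λ z → a * z + b * 0) (e zero)
mulLin-cong a b e (suc m) = cong₂ (λ u v → a * u + b * v) (e (suc m)) (e m)

mulLin-zeroCoeffs : ∀ a b p m → a ≡ 0 → b ≡ 0 → mulLin a b p m ≡ 0
mulLin-zeroCoeffs .0 .0 p m refl refl = refl

mulLin-zeroSeq : ∀ a b p m → (∀ m → p m ≡ 0) → mulLin a b p m ≡ 0
mulLin-zeroSeq a b p m e = trans (mulLin-cong a b e m) (mulLin-zero m) where
  mulLin-zero : ∀ m → mulLin a b (λ _ → 0) m ≡ 0
  mulLin-zero zero = cong₂ _+_ (*-zeroʳ a) (*-zeroʳ b)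
  mulLin-zero (suc m) = cong₂ _+_ (*-zeroʳ a) (*-zeroʳ b)

shift-sumN : ∀ N (p : ℕ → ℕ → ℕ) m → shift (λ m → sumN N (λ i → p i m)) m ≡ sumN N (λ i → shift (p i) m)
shift-sumN N p zero = sym (sumN-zero N _ (λ _ _ → refl))
shift-sumN N p (suc m) = refl

mulLin-sumN : ∀ a b N (p : ℕ → ℕ → ℕ) m → mulLin a b (λ m → sumN N (λ i → p i m)) m ≡ sumN N (λ i → mulLin a b (p i) m)
mulLin-sumN a b N p m = begin
  a * sumN N (λ i → p i m) + b * shift (λ m → sumN N (λ i → p i m)) m
    ≡⟨ cong₂ _+_ (sym (sumN-* N a _)) (trans (cong (b *_) (shift-sumN N p m)) (sym (sumN-* N b _))) ⟩
  sumN N (λ i → a * p i m) + sumN N (λ i → b * shift (p i) m)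
    ≡⟨ sym (sumN-+ N _ _) ⟩
  sumN N (λ i → mulLin a b (p i) m) ∎
  where open ≡-Reasoning

mulLin-scale : ∀ a b c p m → mulLin a b (λ m → c * p m) m ≡ c * mulLin a b p m
mulLin-scale a b c p zero = ring a b c (p 0) where
  ring : ∀ a b c x → a * (c * x) + b * 0 ≡ c * (a * x + b * 0)
  ring = solve-∀
mulLin-scale a b c p (suc m) = ring a b c (p (suc m)) (p m) where
  ring : ∀ a b c x y → a * (c * x) + b * (c * y) ≡ c * (a * x + b * y)
  ring = solve-∀

mulLin-comm : ∀ a b c d p m → mulLin a b (mulLin c d p) m ≡ mulLin c d (mulLin a b p) m
mulLin-comm a b c d p zero = ring a b c d (p 0) where
  ring : ∀ a b c d x → a * (c * x + d * 0) + b * 0 ≡ c * (a * x + b * 0) + d * 0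
  ring = solve-∀
mulLin-comm a b c d p (suc m) = ring a b c d (p (suc m)) (p m) (shift p m) where
  ring : ∀ a b c d x y z → a * (c * x + d * y) + b * (c * y + d * z) ≡ c * (a * x + b * y) + d * (a * y + b * z)
  ring = solve-∀

δ₀ : ℕ → ℕ
δ₀ m = ⟦ m ≡ᵇ 0 ⟧

coeff-⊕ : ∀ p q m → coeff (p ⊕ q) m ≡ coeff p m + coeff q m
coeff-⊕ [] q m = refl
coeff-⊕ (a ∷ p) [] m = sym (+-identityʳ _)
coeff-⊕ (a ∷ p) (b ∷ q) zero = refl
coeff-⊕ (a ∷ p) (b ∷ q) (suc m) = coeff-⊕ p q m

coeff-scale : ∀ c p m → coeff (scale c p) m ≡ c * coeff p m
coeff-scale c [] m = sym (*-zeroʳ c)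
coeff-scale c (a ∷ p) zero = refl
coeff-scale c (a ∷ p) (suc m) = coeff-scale c p m

coeff-foldr : ∀ (f : ℕ → Poly) xs m → coeff (foldr _⊕_ [] (map f xs)) m ≡ sumL (λ j → coeff (f j) m) xs
coeff-foldr f [] m = refl
coeff-foldr f (x ∷ xs) m = trans (coeff-⊕ (f x) _ m) (cong (coeff (f x) m +_) (coeff-foldr f xs m))

risingCoeff : ℕ → ℕ → ℕ
risingCoeff j m = coeff (rising j) m

risingCoeff-zero : ∀ m → risingCoeff 0 m ≡ δ₀ m
risingCoeff-zero zero = refl
risingCoeff-zero (suc m) = refl

risingCoeff-suc : ∀ j m → risingCoeff (suc j) m ≡ shift (risingCoeff j) m + suc j * risingCoeff j m
risingCoeff-suc j m = trans (coeff-⊕ (0 ∷ rising j) (scale (suc j) (rising j)) m)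
                  (cong₂ _+_ (c0 m) (coeff-scale (suc j) (rising j) m)) where
  c0 : ∀ m → coeff (0 ∷ rising j) m ≡ shift (risingCoeff j) m
  c0 zero = refl
  c0 (suc m) = refl

-- The transfer matrix

binm1 : ℕ → ℕ → ℕ
binm1 r zero = 0
binm1 r (suc s) = r C s

-- T r s = T₀ r s + T₁ r s · x counts the trees in which 0^b has s red children that contract to a
-- given tree in which 0^b has r red children, x marking whether 1^b contributes to w^ch.
T₀ : ℕ → ℕ → ℕ
T₀ r s = ⟦ s ≡ᵇ r ⟧ + ⟦ s ≤ᵇ r ⟧ * binm1 r s

T₁ : ℕ → ℕ → ℕ
T₁ r s = ⟦ s <ᵇ r ⟧ * (r C s)

T₀-vanish : ∀ r s → r < s → T₀ r s ≡ 0
T₀-vanish r s lt rewrite ≢⇒≡ᵇ≡false s r (λ e → <⇒≢ lt (sym e)) | >⇒≤ᵇ≡false s r lt = refl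

T₁-vanish : ∀ r s → r < s → T₁ r s ≡ 0
T₁-vanish r s lt rewrite ≥⇒<ᵇ≡false s r (<⇒≤ lt) = refl

-- The coefficient sequence of the entry (n , s) of T^k, obtained by splitting off the last factor.
Tpow : ℕ → ℕ → ℕ → ℕ → ℕ
Tpow n zero r m = ⟦ r ≡ᵇ n ⟧ * ⟦ m ≡ᵇ 0 ⟧
Tpow n (suc k) s m = sumN (suc n) (λ r → mulLin (T₀ r s) (T₁ r s) (Tpow n k r) m)

Tpow-vanish : ∀ n k r m → n < r → Tpow n k r m ≡ 0
Tpow-vanish n zero r m lt rewrite ≢⇒≡ᵇ≡false r n (λ e → <⇒≢ lt (sym e)) = refl
Tpow-vanish n (suc k) r m lt = sumN-zero (suc n) (λ r' → mulLin (T₀ r' r) (T₁ r' r) (Tpow n k r') m) (λ r' lt' →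
  mulLin-zeroCoeffs _ _ (Tpow n k r') m (T₀-vanish r' r (<-≤-trans lt' lt)) (T₁-vanish r' r (<-≤-trans lt' lt)))

Tpow-range : ∀ n s k t m → s ≤ n →
  sumN (suc n) (λ r → mulLin (T₀ r t) (T₁ r t) (Tpow s k r) m) ≡ Tpow s (suc k) t m
Tpow-range n s k t m le = sumN-extend (suc s) (suc n) (λ r → mulLin (T₀ r t) (T₁ r t) (Tpow s k r) m) (s≤s le)
  (λ r sr → mulLin-zeroSeq (T₀ r t) (T₁ r t) (Tpow s k r) m (λ m' → Tpow-vanish s k r m' sr))

-- Splitting off the first factor instead; the entries of T commute, being polynomials in x.
Tpow-firstStep : ∀ k n t m → Tpow n (suc k) t m ≡ sumN (suc n) (λ s → mulLin (T₀ n s) (T₁ n s) (λ m → Tpow s k t m) m)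
Tpow-firstStep zero n t m = begin
  sumN (suc n) (λ r → mulLin (T₀ r t) (T₁ r t) (λ m → ⟦ r ≡ᵇ n ⟧ * δ₀ m) m)
    ≡⟨ sumN-cong (suc n) (λ r _ → mulLin-scale (T₀ r t) (T₁ r t) ⟦ r ≡ᵇ n ⟧ δ₀ m) ⟩
  sumN (suc n) (λ r → ⟦ r ≡ᵇ n ⟧ * mulLin (T₀ r t) (T₁ r t) δ₀ m)
    ≡⟨ sumN-indicator (suc n) n (λ r → mulLin (T₀ r t) (T₁ r t) δ₀ m) (⊥-elim ∘ 1+n≰n) ⟩
  mulLin (T₀ n t) (T₁ n t) δ₀ m
    ≡⟨ sumN-indicator (suc n) t (λ s → mulLin (T₀ n s) (T₁ n s) δ₀ m)
         (λ n<t → mulLin-zeroCoeffs _ _ δ₀ m (T₀-vanish n t n<t) (T₁-vanish n t n<t)) ⟨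
  sumN (suc n) (λ s → ⟦ s ≡ᵇ t ⟧ * mulLin (T₀ n s) (T₁ n s) δ₀ m)
    ≡⟨ sumN-cong (suc n) (λ s _ → trans (cong (λ b → ⟦ b ⟧ * mulLin (T₀ n s) (T₁ n s) δ₀ m) (≡ᵇ-sym s t))
                                       (sym (mulLin-scale (T₀ n s) (T₁ n s) ⟦ t ≡ᵇ s ⟧ δ₀ m))) ⟩
  sumN (suc n) (λ s → mulLin (T₀ n s) (T₁ n s) (λ m → ⟦ t ≡ᵇ s ⟧ * δ₀ m) m) ∎
  where open ≡-Reasoning
Tpow-firstStep (suc k) n t m = begin
  sumN (suc n) (λ r → mulLin (T₀ r t) (T₁ r t) (Tpow n (suc k) r) m)
    ≡⟨ sumN-cong (suc n) (λ r _ → mulLin-cong (T₀ r t) (T₁ r t) (λ m' → Tpow-firstStep k n r m') m) ⟩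
  sumN (suc n) (λ r → mulLin (T₀ r t) (T₁ r t) (λ m' → sumN (suc n) (λ s → mulLin (T₀ n s) (T₁ n s) (λ m → Tpow s k r m) m')) m)
    ≡⟨ sumN-cong (suc n) (λ r _ → mulLin-sumN (T₀ r t) (T₁ r t) (suc n) (λ s → mulLin (T₀ n s) (T₁ n s) (λ m → Tpow s k r m)) m) ⟩
  sumN (suc n) (λ r → sumN (suc n) (λ s → mulLin (T₀ r t) (T₁ r t) (mulLin (T₀ n s) (T₁ n s) (Tpow s k r)) m))
    ≡⟨ sumN-swap (suc n) (suc n) (λ r s → mulLin (T₀ r t) (T₁ r t) (mulLin (T₀ n s) (T₁ n s) (Tpow s k r)) m) ⟩
  sumN (suc n) (λ s → sumN (suc n) (λ r → mulLin (T₀ r t) (T₁ r t) (mulLin (T₀ n s) (T₁ n s) (Tpow s k r)) m))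
    ≡⟨ sumN-cong (suc n) (λ s _ → sumN-cong (suc n) (λ r _ → mulLin-comm (T₀ r t) (T₁ r t) (T₀ n s) (T₁ n s) (Tpow s k r) m)) ⟩
  sumN (suc n) (λ s → sumN (suc n) (λ r → mulLin (T₀ n s) (T₁ n s) (mulLin (T₀ r t) (T₁ r t) (Tpow s k r)) m))
    ≡⟨ sumN-cong (suc n) (λ s _ → sym (mulLin-sumN (T₀ n s) (T₁ n s) (suc n) (λ r → mulLin (T₀ r t) (T₁ r t) (Tpow s k r)) m)) ⟩
  sumN (suc n) (λ s → mulLin (T₀ n s) (T₁ n s) (λ m' → sumN (suc n) (λ r → mulLin (T₀ r t) (T₁ r t) (Tpow s k r) m')) m)
    ≡⟨ sumN-cong (suc n) (λ s s< → mulLin-cong (T₀ n s) (T₁ n s) (λ m' → Tpow-range n s k t m' (≤-pred s<)) m) ⟩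
  sumN (suc n) (λ s → mulLin (T₀ n s) (T₁ n s) (λ m → Tpow s (suc k) t m) m) ∎
  where open ≡-Reasoning

Trow : ℕ → ℕ → ℕ → ℕ
Trow n k m = sumN (suc n) (λ r → Tpow n k r m)

RowRecurrence : (ℕ → ℕ → ℕ → ℕ) → Set
RowRecurrence X = ∀ n k m → X n (suc k) m ≡ sumN (suc n) (λ s → mulLin (T₀ n s) (T₁ n s) (X s k) m)

RowBase : (ℕ → ℕ → ℕ → ℕ) → Set
RowBase X = ∀ n m → X n zero m ≡ δ₀ m

Trow-base : RowBase Trow
Trow-base n m = sumN-indicator (suc n) n (λ _ → δ₀ m) (⊥-elim ∘ 1+n≰n)

Trow-rec : RowRecurrence Trow
Trow-rec n k m = begin
  sumN (suc n) (λ t → Tpow n (suc k) t m)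
    ≡⟨ sumN-cong (suc n) (λ t _ → Tpow-firstStep k n t m) ⟩
  sumN (suc n) (λ t → sumN (suc n) (λ s → mulLin (T₀ n s) (T₁ n s) (λ m → Tpow s k t m) m))
    ≡⟨ sumN-swap (suc n) (suc n) (λ t s → mulLin (T₀ n s) (T₁ n s) (λ m → Tpow s k t m) m) ⟩
  sumN (suc n) (λ s → sumN (suc n) (λ t → mulLin (T₀ n s) (T₁ n s) (λ m → Tpow s k t m) m))
    ≡⟨ sumN-cong (suc n) (λ s _ → sym (mulLin-sumN (T₀ n s) (T₁ n s) (suc n) (λ t m → Tpow s k t m) m)) ⟩
  sumN (suc n) (λ s → mulLin (T₀ n s) (T₁ n s) (λ m → sumN (suc n) (λ t → Tpow s k t m)) m)
    ≡⟨ sumN-cong (suc n) (λ s s< → mulLin-cong (T₀ n s) (T₁ n s)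
         (λ m' → sumN-extend (suc s) (suc n) (λ t → Tpow s k t m') (s≤s (≤-pred s<)) (λ t st → Tpow-vanish s k t m' st)) m) ⟩
  sumN (suc n) (λ s → mulLin (T₀ n s) (T₁ n s) (Trow s k) m) ∎
  where open ≡-Reasoning

rowRecurrence-unique : ∀ X Y → RowBase X → RowBase Y → RowRecurrence X → RowRecurrence Y → ∀ k n m → X n k m ≡ Y n k m
rowRecurrence-unique X Y bx by rx ry zero n m = trans (bx n m) (sym (by n m))
rowRecurrence-unique X Y bx by rx ry (suc k) n m = trans (rx n k m) (trans
  (sumN-cong (suc n) (λ s _ → mulLin-cong (T₀ n s) (T₁ n s) (λ m' → rowRecurrence-unique X Y bx by rx ry k s m') m))
  (sym (ry n k m)))

S-vanish : ∀ n k → n < k → S n k ≡ 0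
S-vanish zero (suc k) lt = refl
S-vanish (suc n) (suc k) (s≤s lt) rewrite S-vanish n (suc k) (m<n⇒m<1+n lt) | S-vanish n k lt = trans (+-identityʳ _) (*-zeroʳ k)

S-one : ∀ n → S (suc n) 1 ≡ 1
S-one zero = refl
S-one (suc n) rewrite S-one n = refl

binomStirling : ℕ → ℕ → ℕ
binomStirling n t = sumN (suc n) (λ s → (n C s) * S (suc s) t)

binomStirling₂ : ℕ → ℕ → ℕ
binomStirling₂ n t = sumN (suc n) (λ s → (n C s) * S (suc (suc s)) t)

binomStirling-suc : ∀ n t → binomStirling (suc n) t ≡ binomStirling n t + binomStirling₂ n t
binomStirling-suc n t = begin
  binomStirling (suc n) t
    ≡⟨ cong (1 * S 1 t +_) (sumN-cong (suc n) (λ s _ → cong (_* S (suc (suc s)) t) (sym (nCk+nC[k+1]≡[n+1]C[k+1] n s)))) ⟩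
  1 * S 1 t + sumN (suc n) (λ s → ((n C s) + (n C (suc s))) * S (suc (suc s)) t)
    ≡⟨ cong (1 * S 1 t +_) (trans (sumN-cong (suc n) (λ s _ → *-distribʳ-+ (S (suc (suc s)) t) (n C s) (n C (suc s))))
                                 (sumN-+ (suc n) (λ s → (n C s) * S (suc (suc s)) t) g)) ⟩
  1 * S 1 t + (binomStirling₂ n t + sumN (suc n) g)
    ≡⟨ cong (λ z → 1 * S 1 t + (binomStirling₂ n t + z)) (sumN-snoc n g) ⟩
  1 * S 1 t + (binomStirling₂ n t + (sumN n g + (n C (suc n)) * S (suc (suc n)) t))
    ≡⟨ cong (λ z → 1 * S 1 t + (binomStirling₂ n t + (sumN n g + z * S (suc (suc n)) t))) (k>n⇒nCk≡0 (n<1+n n)) ⟩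
  1 * S 1 t + (binomStirling₂ n t + (sumN n g + 0))
    ≡⟨ ring (1 * S 1 t) (binomStirling₂ n t) (sumN n g) ⟩
  (1 * S 1 t + sumN n g) + binomStirling₂ n t ∎
  where
  open ≡-Reasoning
  g : ℕ → ℕ
  g s = (n C (suc s)) * S (suc (suc s)) t
  ring : ∀ a b c → a + (b + (c + 0)) ≡ (a + c) + b
  ring = solve-∀

binomStirling₂-suc : ∀ n t → binomStirling₂ n (suc t) ≡ suc t * binomStirling n (suc t) + binomStirling n t
binomStirling₂-suc n t = begin
  sumN (suc n) (λ s → (n C s) * S (suc (suc s)) (suc t))
    ≡⟨ sumN-cong (suc n) (λ s _ → ring (n C s) (suc t) (S (suc s) (suc t)) (S (suc s) t)) ⟩
  sumN (suc n) (λ s → suc t * ((n C s) * S (suc s) (suc t)) + (n C s) * S (suc s) t)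
    ≡⟨ sumN-+ (suc n) (λ s → suc t * ((n C s) * S (suc s) (suc t))) (λ s → (n C s) * S (suc s) t) ⟩
  sumN (suc n) (λ s → suc t * ((n C s) * S (suc s) (suc t))) + binomStirling n t
    ≡⟨ cong (_+ binomStirling n t) (sumN-* (suc n) (suc t) (λ s → (n C s) * S (suc s) (suc t))) ⟩
  suc t * binomStirling n (suc t) + binomStirling n t ∎
  where
  open ≡-Reasoning
  ring : ∀ b u x y → b * (u * x + y) ≡ u * (b * x) + b * y
  ring = solve-∀

binomStirling₂-zero : ∀ n → binomStirling₂ n 0 ≡ 0
binomStirling₂-zero n = sumN-zero (suc n) (λ s → (n C s) * S (suc (suc s)) 0) (λ s _ → *-zeroʳ (n C s))

binomStirling-closed : ∀ n t → binomStirling n t ≡ t * S (suc n) (suc t) + S (suc n) t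
binomStirling-closed zero zero = refl
binomStirling-closed zero (suc zero) = refl
binomStirling-closed zero (suc (suc t)) rewrite S-vanish 0 (suc t) (s≤s z≤n) | S-vanish 0 (suc (suc t)) (s≤s z≤n) | *-zeroʳ (suc t) | *-zeroʳ (suc (suc t)) = refl
binomStirling-closed (suc n) zero = trans (binomStirling-suc n 0) (cong₂ _+_ (binomStirling-closed n 0) (binomStirling₂-zero n))
binomStirling-closed (suc n) (suc t) rewrite binomStirling-suc n (suc t) | binomStirling₂-suc n t | binomStirling-closed n (suc t) | binomStirling-closed n t =
  ring (S (suc n) (suc (suc t))) (S (suc n) (suc t)) (S (suc n) t) t where
  ring : ∀ x y z t → (suc t * x + y) + (suc t * (suc t * x + y) + (t * y + z))
                   ≡ suc t * (suc (suc t) * x + y) + (suc t * y + z)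
  ring = solve-∀

sumN-T₁-S : ∀ n j → sumN (suc n) (λ s → T₁ n s * S (suc s) (suc j)) ≡ suc j * S (suc n) (suc (suc j))
sumN-T₁-S n j = +-cancelʳ-≡ _ _ _ (begin
  sumN (suc n) f + S (suc n) (suc j)
    ≡⟨ cong (_+ S (suc n) (suc j)) (sumN-snoc n f) ⟩
  (sumN n f + T₁ n n * S (suc n) (suc j)) + S (suc n) (suc j)
    ≡⟨ cong (λ b → (sumN n f + ⟦ b ⟧ * (n C n) * S (suc n) (suc j)) + S (suc n) (suc j)) (≥⇒<ᵇ≡false n n ≤-refl) ⟩
  (sumN n f + 0) + S (suc n) (suc j)
    ≡⟨ cong (λ z → (z + 0) + S (suc n) (suc j)) (sumN-cong n (λ s s<n → trans (cong (λ b → ⟦ b ⟧ * (n C s) * S (suc s) (suc j)) (<⇒<ᵇ≡true s n s<n)) (cong (_* S (suc s) (suc j)) (*-identityˡ (n C s))))) ⟩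
  (sumN n g + 0) + S (suc n) (suc j)
    ≡⟨ cong (λ z → (sumN n g + 0) + z) (sym (trans (cong (_* S (suc n) (suc j)) (nCn≡1 n)) (*-identityˡ _))) ⟩
  (sumN n g + 0) + (n C n) * S (suc n) (suc j)
    ≡⟨ cong (_+ (n C n) * S (suc n) (suc j)) (+-identityʳ _) ⟩
  sumN n g + g n
    ≡⟨ sym (sumN-snoc n g) ⟩
  binomStirling n (suc j)
    ≡⟨ binomStirling-closed n (suc j) ⟩
  suc j * S (suc n) (suc (suc j)) + S (suc n) (suc j) ∎)
  where
  open ≡-Reasoning
  f : ℕ → ℕ
  f s = T₁ n s * S (suc s) (suc j)
  g : ℕ → ℕ
  g s = (n C s) * S (suc s) (suc j)

sumN-T₀-S : ∀ n j → sumN (suc n) (λ s → T₀ n s * S (suc s) (suc j)) ≡ suc j * S (suc n) (suc j) + suc j * suc j * S (suc n) (suc (suc j))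
sumN-T₀-S n j = begin
  sumN (suc n) (λ s → T₀ n s * S (suc s) (suc j))
    ≡⟨ sumN-cong (suc n) T₀-split ⟩
  sumN (suc n) (λ s → ⟦ s ≡ᵇ n ⟧ * S (suc s) (suc j) + binm1 n s * S (suc s) (suc j))
    ≡⟨ sumN-+ (suc n) (λ s → ⟦ s ≡ᵇ n ⟧ * S (suc s) (suc j)) (λ s → binm1 n s * S (suc s) (suc j)) ⟩
  sumN (suc n) (λ s → ⟦ s ≡ᵇ n ⟧ * S (suc s) (suc j)) + X
    ≡⟨ cong (_+ X) (sumN-indicator (suc n) n (λ s → S (suc s) (suc j)) (⊥-elim ∘ 1+n≰n)) ⟩
  y + X
    ≡⟨ cong (y +_) X≡ ⟩
  y + (suc j * suc j * w + j * y)
    ≡⟨ ring₂ y w j ⟩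
  suc j * y + suc j * suc j * w ∎
  where
  open ≡-Reasoning
  y = S (suc n) (suc j)
  z = S (suc n) j
  w = S (suc n) (suc (suc j))
  h : ℕ → ℕ
  h s = (n C s) * S (suc (suc s)) (suc j)
  X = sumN n h
  T₀-split : ∀ s → s < suc n → T₀ n s * S (suc s) (suc j) ≡ ⟦ s ≡ᵇ n ⟧ * S (suc s) (suc j) + binm1 n s * S (suc s) (suc j)
  T₀-split s lt rewrite ≤⇒≤ᵇ≡true s n (≤-pred lt) = ring ⟦ s ≡ᵇ n ⟧ (binm1 n s) (S (suc s) (suc j)) where
    ring : ∀ a b c → (a + 1 * b) * c ≡ a * c + b * c
    ring = solve-∀
  X+last : X + 1 * (suc j * y + z) ≡ suc j * (suc j * w + y) + (j * y + z)
  X+last = begin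
    X + 1 * (suc j * y + z) ≡⟨ cong (λ u → X + u * (suc j * y + z)) (sym (nCn≡1 n)) ⟩
    X + h n ≡⟨ sym (sumN-snoc n h) ⟩
    binomStirling₂ n (suc j) ≡⟨ binomStirling₂-suc n j ⟩
    suc j * binomStirling n (suc j) + binomStirling n j ≡⟨ cong₂ (λ a b → suc j * a + b) (binomStirling-closed n (suc j)) (binomStirling-closed n j) ⟩
    suc j * (suc j * w + y) + (j * y + z) ∎
  X≡ : X ≡ suc j * suc j * w + j * y
  X≡ = +-cancelʳ-≡ _ _ _ (trans (trans (cong (X +_) (sym (*-identityˡ _))) X+last) (ring w y z j)) where
    ring : ∀ w y z j → suc j * (suc j * w + y) + (j * y + z) ≡ (suc j * suc j * w + j * y) + (suc j * y + z)
    ring = solve-∀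
  ring₂ : ∀ y w j → y + (suc j * suc j * w + j * y) ≡ suc j * y + suc j * suc j * w
  ring₂ = solve-∀

bhatWeight : ℕ → ℕ → ℕ → ℕ
bhatWeight n k j = (j !) * S (suc n) (suc j) * S (suc k) (suc j)

bhatCoeff : ℕ → ℕ → ℕ → ℕ
bhatCoeff n k m = sumN (suc n) (λ j → bhatWeight n k j * risingCoeff j m)

bhatWeight-vanishˡ : ∀ n k j → n < j → bhatWeight n k j ≡ 0
bhatWeight-vanishˡ n k j lt rewrite S-vanish (suc n) (suc j) (s≤s lt) | *-zeroʳ (j !) = refl

bhatWeight-vanishʳ : ∀ n k j → k < j → bhatWeight n k j ≡ 0
bhatWeight-vanishʳ n k j lt rewrite S-vanish (suc k) (suc j) (s≤s lt) = *-zeroʳ ((j !) * S (suc n) (suc j))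

coeff-Bhat : ∀ n k m → coeff (Bhat n k) m ≡ bhatCoeff n k m
coeff-Bhat n k m = begin
  coeff (Bhat n k) m
    ≡⟨ coeff-foldr (λ j → scale (bhatWeight n k j) (rising j)) (upTo (suc (n ⊓ k))) m ⟩
  sumL (λ j → coeff (scale (bhatWeight n k j) (rising j)) m) (upTo (suc (n ⊓ k)))
    ≡⟨ sumL-cong (upTo (suc (n ⊓ k))) (λ j → coeff-scale (bhatWeight n k j) (rising j) m) ⟩
  sumL (λ j → bhatWeight n k j * risingCoeff j m) (upTo (suc (n ⊓ k)))
    ≡⟨ sumL-upTo (suc (n ⊓ k)) (λ j → bhatWeight n k j * risingCoeff j m) ⟩
  sumN (suc (n ⊓ k)) (λ j → bhatWeight n k j * risingCoeff j m)
    ≡⟨ sym (sumN-extend (suc (n ⊓ k)) (suc n) (λ j → bhatWeight n k j * risingCoeff j m) (s≤s (m⊓n≤m n k)) vanish) ⟩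
  bhatCoeff n k m ∎
  where
  open ≡-Reasoning
  vanish : ∀ j → suc (n ⊓ k) ≤ j → bhatWeight n k j * risingCoeff j m ≡ 0
  vanish j le with j ≤? n | j ≤? k
  ... | yes a | yes b = ⊥-elim (<⇒≱ le (⊓-glb a b))
  ... | _ | no b = cong (_* risingCoeff j m) (bhatWeight-vanishʳ n k j (≰⇒> b))
  ... | no a | _ = cong (_* risingCoeff j m) (bhatWeight-vanishˡ n k j (≰⇒> a))

bhatCoeff-base : RowBase bhatCoeff
bhatCoeff-base n m = begin
  bhatWeight n 0 0 * risingCoeff 0 m + sumN n (λ j → bhatWeight n 0 (suc j) * risingCoeff (suc j) m)
    ≡⟨ cong₂ _+_ (cong₂ _*_ c00 (risingCoeff-zero m)) (sumN-zero n (λ j → bhatWeight n 0 (suc j) * risingCoeff (suc j) m) (λ j _ → cong (_* risingCoeff (suc j) m) (bhatWeight-vanishʳ n 0 (suc j) (s≤s z≤n)))) ⟩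
  1 * δ₀ m + 0
    ≡⟨ trans (+-identityʳ _) (*-identityˡ _) ⟩
  δ₀ m ∎
  where
  open ≡-Reasoning
  c00 : bhatWeight n 0 0 ≡ 1
  c00 rewrite S-one n = refl

sumN-lin2 : ∀ N K P Q (f g : ℕ → ℕ) → sumN N (λ s → K * (P * f s + Q * g s)) ≡ K * (P * sumN N f + Q * sumN N g)
sumN-lin2 zero K P Q f g = ring K P Q where
  ring : ∀ K P Q → 0 ≡ K * (P * 0 + Q * 0)
  ring = solve-∀
sumN-lin2 (suc N) K P Q f g rewrite sumN-lin2 N K P Q (f ∘ suc) (g ∘ suc) = ring K P Q (f 0) (g 0) (sumN N (f ∘ suc)) (sumN N (g ∘ suc)) where
  ring : ∀ K P Q a b c d → K * (P * a + Q * b) + K * (P * c + Q * d) ≡ K * (P * (a + c) + Q * (b + d))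
  ring = solve-∀

bhatCoeff-extend : ∀ n s k m → s ≤ n → bhatCoeff s k m ≡ sumN (suc n) (λ j → bhatWeight s k j * risingCoeff j m)
bhatCoeff-extend n s k m le = sym (sumN-extend (suc s) (suc n) (λ j → bhatWeight s k j * risingCoeff j m) (s≤s le)
  (λ j lt → cong (_* risingCoeff j m) (bhatWeight-vanishˡ s k j lt)))

-- The Stirling recurrence in k, re-indexed with the identities sumN-T₀-S and sumN-T₁-S.
bhatCoeff-suc : ∀ n k m → bhatCoeff n (suc k) m ≡
  sumN (suc n) (λ j → ((j !) * S (suc k) (suc j)) * (risingCoeff j m * sumN (suc n) (λ s → T₀ n s * S (suc s) (suc j))
                                                   + shift (risingCoeff j) m * sumN (suc n) (λ s → T₁ n s * S (suc s) (suc j))))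
bhatCoeff-suc n k m = begin
  bhatCoeff n (suc k) m
    ≡⟨ sumN-cong (suc n) (λ j _ → split j) ⟩
  sumN (suc n) (λ j → A j + B j)
    ≡⟨ sumN-+ (suc n) A B ⟩
  sumN (suc n) A + (B 0 + sumN n B′)
    ≡⟨ cong (λ z → sumN (suc n) A + (z + sumN n B′)) B0≡0 ⟩
  sumN (suc n) A + sumN n B′
    ≡⟨ cong (sumN (suc n) A +_) (sym (trans (sumN-snoc n B′) (trans (cong (sumN n B′ +_) B′n≡0) (+-identityʳ _)))) ⟩
  sumN (suc n) A + sumN (suc n) B′
    ≡⟨ sym (sumN-+ (suc n) A B′) ⟩
  sumN (suc n) (λ j → A j + B′ j)
    ≡⟨ sumN-cong (suc n) (λ j _ → sym (regroup j)) ⟩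
  _ ∎
  where
  open ≡-Reasoning
  A B B′ : ℕ → ℕ
  A j = ((j !) * S (suc n) (suc j)) * (suc j * S (suc k) (suc j)) * risingCoeff j m
  B j = ((j !) * S (suc n) (suc j)) * S (suc k) j * risingCoeff j m
  B′ j = B (suc j)
  split : ∀ j → bhatWeight n (suc k) j * risingCoeff j m ≡ A j + B j
  split j = ring ((j !) * S (suc n) (suc j)) (suc j * S (suc k) (suc j)) (S (suc k) j) (risingCoeff j m) where
    ring : ∀ a b c r → a * (b + c) * r ≡ a * b * r + a * c * r
    ring = solve-∀
  B0≡0 : B 0 ≡ 0
  B0≡0 = cong (_* risingCoeff 0 m) (*-zeroʳ ((0 !) * S (suc n) 1))
  B′n≡0 : B′ n ≡ 0
  B′n≡0 rewrite S-vanish (suc n) (suc (suc n)) (s≤s (n<1+n n)) | *-zeroʳ (suc n !) = refl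
  regroup : ∀ j → ((j !) * S (suc k) (suc j)) * (risingCoeff j m * sumN (suc n) (λ s → T₀ n s * S (suc s) (suc j))
                 + shift (risingCoeff j) m * sumN (suc n) (λ s → T₁ n s * S (suc s) (suc j))) ≡ A j + B′ j
  regroup j rewrite sumN-T₀-S n j | sumN-T₁-S n j | risingCoeff-suc j m =
    ring (j !) (S (suc k) (suc j)) (risingCoeff j m) (shift (risingCoeff j) m) (S (suc n) (suc j)) (S (suc n) (suc (suc j))) j where
    ring : ∀ f K r h y w j → (f * K) * (r * (suc j * y + suc j * suc j * w) + h * (suc j * w))
          ≡ (f * y) * (suc j * K) * r + ((suc j * f) * w) * K * (h + suc j * r)
    ring = solve-∀

bhatCoeff-rec : RowRecurrence bhatCoeff
bhatCoeff-rec n k m = begin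
  bhatCoeff n (suc k) m
    ≡⟨ bhatCoeff-suc n k m ⟩
  sumN (suc n) (λ j → ((j !) * S (suc k) (suc j)) * (risingCoeff j m * sumN (suc n) (λ s → T₀ n s * S (suc s) (suc j))
                                                   + shift (risingCoeff j) m * sumN (suc n) (λ s → T₁ n s * S (suc s) (suc j))))
    ≡⟨ sumN-cong (suc n) (λ j _ → sym (sumN-lin2 (suc n) ((j !) * S (suc k) (suc j)) (risingCoeff j m) (shift (risingCoeff j) m)
                                                  (λ s → T₀ n s * S (suc s) (suc j)) (λ s → T₁ n s * S (suc s) (suc j)))) ⟩
  sumN (suc n) (λ j → sumN (suc n) (λ s → ((j !) * S (suc k) (suc j)) * (risingCoeff j m * (T₀ n s * S (suc s) (suc j))
                                                   + shift (risingCoeff j) m * (T₁ n s * S (suc s) (suc j)))))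
    ≡⟨ sumN-cong (suc n) (λ j _ → sumN-cong (suc n) (λ s _ → regroup j s)) ⟩
  sumN (suc n) (λ j → sumN (suc n) (λ s → mulLin (T₀ n s) (T₁ n s) (λ m′ → bhatWeight s k j * risingCoeff j m′) m))
    ≡⟨ sumN-swap (suc n) (suc n) (λ j s → mulLin (T₀ n s) (T₁ n s) (λ m′ → bhatWeight s k j * risingCoeff j m′) m) ⟩
  sumN (suc n) (λ s → sumN (suc n) (λ j → mulLin (T₀ n s) (T₁ n s) (λ m′ → bhatWeight s k j * risingCoeff j m′) m))
    ≡⟨ sumN-cong (suc n) (λ s _ → sym (mulLin-sumN (T₀ n s) (T₁ n s) (suc n) (λ j m′ → bhatWeight s k j * risingCoeff j m′) m)) ⟩
  sumN (suc n) (λ s → mulLin (T₀ n s) (T₁ n s) (λ m′ → sumN (suc n) (λ j → bhatWeight s k j * risingCoeff j m′)) m)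
    ≡⟨ sumN-cong (suc n) (λ s s< → mulLin-cong (T₀ n s) (T₁ n s) (λ m′ → sym (bhatCoeff-extend n s k m′ (≤-pred s<))) m) ⟩
  sumN (suc n) (λ s → mulLin (T₀ n s) (T₁ n s) (bhatCoeff s k) m) ∎
  where
  open ≡-Reasoning
  regroup : ∀ j s → ((j !) * S (suc k) (suc j)) * (risingCoeff j m * (T₀ n s * S (suc s) (suc j))
                                                 + shift (risingCoeff j) m * (T₁ n s * S (suc s) (suc j)))
                    ≡ mulLin (T₀ n s) (T₁ n s) (λ m′ → bhatWeight s k j * risingCoeff j m′) m
  regroup j s = trans (ring (j !) (S (suc k) (suc j)) (risingCoeff j m) (shift (risingCoeff j) m) (T₀ n s) (T₁ n s) (S (suc s) (suc j)))
                      (sym (mulLin-scale (T₀ n s) (T₁ n s) (bhatWeight s k j) (risingCoeff j) m)) where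
    ring : ∀ f K r h a b y → (f * K) * (r * (a * y) + h * (b * y)) ≡ f * y * K * (a * r + b * h)
    ring = solve-∀

Trow≡bhatCoeff : ∀ k n m → Trow n k m ≡ bhatCoeff n k m
Trow≡bhatCoeff = rowRecurrence-unique Trow bhatCoeff Trow-base bhatCoeff-base Trow-rec bhatCoeff-rec

-- Double alternative trees

redOK : ∀ {n k} → Vec (Fin (suc n)) k → Fin n → Fin (suc k) → Bool
redOK pb i zero = true
redOK pb i (suc j) = toℕ (lookup pb j) ≤ᵇ toℕ i

blueOK : ∀ {n k} → Vec (Fin (suc k)) n → Fin k → Fin (suc n) → Bool
blueOK pr j zero = true
blueOK pr j (suc i) = toℕ (lookup pr i) ≤ᵇ toℕ j

-- In alternating trees the same-coloured ancestors of a vertex are its grandparent, its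
-- great-great-grandparent, …, so the descendant condition of isDAT need only be checked on
-- grandparents, and acyclicity then comes for free (isDAT≡grandparentsOK).
grandparentsOK : ∀ {n k} → ParentData n k → Bool
grandparentsOK {n} {k} (pr , pb) = allF n (λ i → redOK pb i (lookup pr i)) ∧ allF k (λ j → blueOK pr j (lookup pb j))

wch′ : ∀ {n k} → ParentData n k → ℕ
wch′ {n} {k} (pr , pb) = sumF k (λ j → ⟦ (lookup pb j ≡ᶠ zero) ∧ anyF n (λ i → lookup pr i ≡ᶠ suc j) ⟧)

wch≡wch′ : ∀ {n k} (t : ParentData n k) → wch t ≡ wch′ t
wch≡wch′ {n} {k} (pr , pb) = trans (countB-tabulate k _ id)
  (sumF-cong k (λ j → cong (λ b → ⟦ (lookup pb j ≡ᶠ zero) ∧ b ⟧) (any-tabulate n (λ i → lookup pr i ≡ᶠ suc j) id)))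

all-allVtx : ∀ n k (p : Vtx n k → Bool) → all p (allVtx n k) ≡ true → ∀ v → p v ≡ true
all-allVtx n k p e (inj₁ a) = allF-elim (suc n) (p ∘ inj₁)
  (trans (sym (trans (all-map p inj₁ (allFin (suc n))) (all-tabulate (suc n) (p ∘ inj₁) id)))
         (proj₁ (∧-elim {all p (map inj₁ (allFin (suc n)))} {all p (map inj₂ (allFin (suc k)))} (trans (sym (all-++ p (map inj₁ (allFin (suc n))) (map inj₂ (allFin (suc k))))) e)))) a
all-allVtx n k p e (inj₂ b) = allF-elim (suc k) (p ∘ inj₂)
  (trans (sym (trans (all-map p inj₂ (allFin (suc k))) (all-tabulate (suc k) (p ∘ inj₂) id)))
         (proj₂ (∧-elim {all p (map inj₁ (allFin (suc n)))} {all p (map inj₂ (allFin (suc k)))} (trans (sym (all-++ p (map inj₁ (allFin (suc n))) (map inj₂ (allFin (suc k))))) e)))) b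

module _ {n k : ℕ} (t : ParentData n k) where
  private
    pr = proj₁ t
    pb = proj₂ t

  descVal : Vtx n k → ℕ → Bool
  descVal v d = maybe (λ u → ancOK u v) true (ancestor t (suc d) v)

  descVal-grandparentʳ : ∀ i → descVal (inj₁ (suc i)) 1 ≡ redOK pb i (lookup pr i)
  descVal-grandparentʳ i with lookup pr i
  ... | zero = refl
  ... | suc j = sym (≤ᵇ≡<ᵇ-suc (toℕ (lookup pb j)) (toℕ i))

  descVal-grandparentᵇ : ∀ j → descVal (inj₂ (suc j)) 1 ≡ blueOK pr j (lookup pb j)
  descVal-grandparentᵇ j with lookup pb j
  ... | zero = refl
  ... | suc i = sym (≤ᵇ≡<ᵇ-suc (toℕ (lookup pr i)) (toℕ j))

1<nV : ∀ n k → 1 < nV n k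
1<nV n k = s≤s (subst (1 ≤_) (sym (+-suc n k)) (s≤s z≤n))

isDAT⇒grandparentsOK : ∀ {n k} (t : ParentData n k) → isDAT t ≡ true → grandparentsOK t ≡ true
isDAT⇒grandparentsOK {n} {k} t e = ∧-intro
  (allF-true n _ (λ i → trans (sym (descVal-grandparentʳ t i)) (grandparent-checked (inj₁ (suc i)))))
  (allF-true k _ (λ j → trans (sym (descVal-grandparentᵇ t j)) (grandparent-checked (inj₂ (suc j)))))
  where
  descOK-true : descOK t ≡ true
  descOK-true = proj₂ (∧-elim {isForest t} {descOK t} e)
  grandparent-checked : ∀ v → descVal t v 1 ≡ true
  grandparent-checked v = all-applyUpTo (descVal t v) id (nV n k) 1
    (all-allVtx n k (λ v → all (λ d → descVal t v d) (upTo (nV n k))) descOK-true v) (1<nV n k)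

module GrandparentsOK {n k : ℕ} (t : ParentData n k) (gt : grandparentsOK t ≡ true) where
  pr = proj₁ t
  pb = proj₂ t

  redGrandparent≤ : ∀ i j → lookup pr i ≡ suc j → toℕ (lookup pb j) ≤ toℕ i
  redGrandparent≤ i j eq = ≤ᵇ≡true⇒≤ _ _ (trans (cong (redOK pb i) (sym eq))
    (allF-elim n _ (proj₁ (∧-elim {allF n (λ i → redOK pb i (lookup pr i))} {allF k (λ j → blueOK pr j (lookup pb j))} gt)) i))

  blueGrandparent≤ : ∀ j i → lookup pb j ≡ suc i → toℕ (lookup pr i) ≤ toℕ j
  blueGrandparent≤ j i eq = ≤ᵇ≡true⇒≤ _ _ (trans (cong (blueOK pr j) (sym eq))
    (allF-elim k _ (proj₂ (∧-elim {allF n (λ i → redOK pb i (lookup pr i))} {allF k (λ j → blueOK pr j (lookup pb j))} gt)) j))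

  -- A potential that strictly decreases from a vertex to its parent.
  μ : Vtx n k → ℕ
  μ (inj₁ zero) = 0
  μ (inj₁ (suc i)) = suc (toℕ i) + toℕ (lookup pr i)
  μ (inj₂ zero) = 0
  μ (inj₂ (suc j)) = suc (toℕ j) + toℕ (lookup pb j)

  μ-step : ∀ a b c → c ≤ a → suc b + c < suc a + suc b
  μ-step a b c le = s≤s (subst (_≤ a + suc b) (+-comm c (suc b)) (+-monoˡ-≤ (suc b) le))

  μ-redParent< : ∀ i → μ (inj₂ (lookup pr i)) < μ (inj₁ (suc i))
  μ-redParent< i with lookup pr i in eq
  ... | zero = s≤s z≤n
  ... | suc j = μ-step (toℕ i) (toℕ j) (toℕ (lookup pb j)) (redGrandparent≤ i j eq)

  μ-blueParent< : ∀ j → μ (inj₁ (lookup pb j)) < μ (inj₂ (suc j))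
  μ-blueParent< j with lookup pb j in eq
  ... | zero = s≤s z≤n
  ... | suc i = μ-step (toℕ j) (toℕ i) (toℕ (lookup pr i)) (blueGrandparent≤ j i eq)

  μ-parent< : ∀ v u → parent t v ≡ just u → μ u < μ v
  μ-parent< (inj₁ (suc i)) .(inj₂ (lookup pr i)) refl = μ-redParent< i
  μ-parent< (inj₂ (suc j)) .(inj₁ (lookup pb j)) refl = μ-blueParent< j

  ancestor-μ-bound : ∀ d v → (ancestor t d v ≡ nothing) ⊎ Σ (Vtx n k) (λ u → (ancestor t d v ≡ just u) × (μ u + d ≤ μ v))
  ancestor-μ-bound zero v = inj₂ (v , refl , ≤-reflexive (+-identityʳ _))
  ancestor-μ-bound (suc d) v with ancestor-μ-bound d v
  ... | inj₁ eq rewrite eq = inj₁ refl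
  ... | inj₂ (u , eq , le) rewrite eq with parent t u in eq2
  ... | nothing = inj₁ refl
  ... | just u' = inj₂ (u' , refl , ≤-trans (subst (_≤ μ u + d) (sym (+-suc (μ u') d)) (+-monoˡ-≤ d (μ-parent< u u' eq2))) le)

  μ≤n+k : ∀ v → μ v ≤ n + k
  μ≤n+k (inj₁ zero) = z≤n
  μ≤n+k (inj₁ (suc i)) = +-mono-≤ (toℕ<n i) (≤-pred (toℕ<n (lookup pr i)))
  μ≤n+k (inj₂ zero) = z≤n
  μ≤n+k (inj₂ (suc j)) = subst (suc (toℕ j + toℕ (lookup pb j)) ≤_) (+-comm k n) (+-mono-≤ (toℕ<n j) (≤-pred (toℕ<n (lookup pb j))))

  ancestor-nV≡nothing : ∀ v → is-nothing (ancestor t (nV n k) v) ≡ true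
  ancestor-nV≡nothing v with ancestor-μ-bound (nV n k) v
  ... | inj₁ eq rewrite eq = refl
  ... | inj₂ (u , eq , le) = ⊥-elim (<⇒≱ big (≤-trans (m≤n+m (nV n k) (μ u)) le)) where
    big : μ v < nV n k
    big = s≤s (≤-trans (μ≤n+k v) (+-monoʳ-≤ n (n≤1+n k)))

  isForest-true : isForest t ≡ true
  isForest-true = all-intro _ (allVtx n k) ancestor-nV≡nothing

  -- Along the ancestor chain of a^r, red vertices are below a, and so are the parents of blue ones.
  InvR : Fin (suc n) → Vtx n k → Set
  InvR a (inj₁ a') = toℕ a' < toℕ a
  InvR a (inj₂ zero) = ⊤
  InvR a (inj₂ (suc j)) = toℕ (lookup pb j) < toℕ a

  InvB : Fin (suc k) → Vtx n k → Set
  InvB b (inj₂ b') = toℕ b' < toℕ b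
  InvB b (inj₁ zero) = ⊤
  InvB b (inj₁ (suc i)) = toℕ (lookup pr i) < toℕ b

  InvR-parent : ∀ i → InvR (suc i) (inj₂ (lookup pr i))
  InvR-parent i with lookup pr i in eq
  ... | zero = tt
  ... | suc j = s≤s (redGrandparent≤ i j eq)

  InvB-parent : ∀ j → InvB (suc j) (inj₁ (lookup pb j))
  InvB-parent j with lookup pb j in eq
  ... | zero = tt
  ... | suc i = s≤s (blueGrandparent≤ j i eq)

  InvR-mono : ∀ a a' b → toℕ a' ≤ toℕ a → InvR a' (inj₂ b) → InvR a (inj₂ b)
  InvR-mono a a' zero le _ = tt
  InvR-mono a a' (suc j) le x = <-≤-trans x le

  InvB-mono : ∀ b b' a → toℕ b' ≤ toℕ b → InvB b' (inj₁ a) → InvB b (inj₁ a)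
  InvB-mono b b' zero le _ = tt
  InvB-mono b b' (suc i) le x = <-≤-trans x le

  Step : (Vtx n k → Set) → Vtx n k → Set
  Step I u = (parent t u ≡ nothing) ⊎ Σ (Vtx n k) (λ u' → (parent t u ≡ just u') × I u')

  InvR-step : ∀ a u → InvR a u → Step (InvR a) u
  InvR-step a (inj₁ zero) x = inj₁ refl
  InvR-step a (inj₁ (suc i)) x = inj₂ (_ , refl , InvR-mono a (suc i) (lookup pr i) (<⇒≤ x) (InvR-parent i))
  InvR-step a (inj₂ zero) x = inj₁ refl
  InvR-step a (inj₂ (suc j)) x = inj₂ (_ , refl , x)

  InvB-step : ∀ b u → InvB b u → Step (InvB b) u
  InvB-step b (inj₂ zero) x = inj₁ refl
  InvB-step b (inj₂ (suc j)) x = inj₂ (_ , refl , InvB-mono b (suc j) (lookup pb j) (<⇒≤ x) (InvB-parent j))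
  InvB-step b (inj₁ zero) x = inj₁ refl
  InvB-step b (inj₁ (suc i)) x = inj₂ (_ , refl , x)

  AncestorChain : (Vtx n k → Set) → Vtx n k → ℕ → Set
  AncestorChain I v d = (ancestor t (suc d) v ≡ nothing) ⊎ Σ (Vtx n k) (λ u → (ancestor t (suc d) v ≡ just u) × I u)

  ancestor-chain : ∀ (I : Vtx n k → Set) v → Step I v → (∀ u → I u → Step I u) → ∀ d → AncestorChain I v d
  ancestor-chain I v s0 st zero = s0
  ancestor-chain I v s0 st (suc d) with ancestor-chain I v s0 st d
  ... | inj₁ eq rewrite eq = inj₁ refl
  ... | inj₂ (u , eq , x) rewrite eq = st u x

  InvR-start : ∀ a → Step (InvR a) (inj₁ a)
  InvR-start zero = inj₁ refl
  InvR-start (suc i) = inj₂ (_ , refl , InvR-parent i)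

  InvB-start : ∀ b → Step (InvB b) (inj₂ b)
  InvB-start zero = inj₁ refl
  InvB-start (suc j) = inj₂ (_ , refl , InvB-parent j)

  InvR⇒ancOK : ∀ a u → InvR a u → ancOK u (inj₁ a) ≡ true
  InvR⇒ancOK a (inj₁ a') x = <⇒<ᵇ≡true (toℕ a') (toℕ a) x
  InvR⇒ancOK a (inj₂ b) x = refl

  InvB⇒ancOK : ∀ b u → InvB b u → ancOK u (inj₂ b) ≡ true
  InvB⇒ancOK b (inj₂ b') x = <⇒<ᵇ≡true (toℕ b') (toℕ b) x
  InvB⇒ancOK b (inj₁ a) x = refl

  descVal-true : ∀ v d → descVal t v d ≡ true
  descVal-true (inj₁ a) d with ancestor-chain (InvR a) (inj₁ a) (InvR-start a) (InvR-step a) d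
  ... | inj₁ eq rewrite eq = refl
  ... | inj₂ (u , eq , x) rewrite eq = InvR⇒ancOK a u x
  descVal-true (inj₂ b) d with ancestor-chain (InvB b) (inj₂ b) (InvB-start b) (InvB-step b) d
  ... | inj₁ eq rewrite eq = refl
  ... | inj₂ (u , eq , x) rewrite eq = InvB⇒ancOK b u x

  isDAT-true : isDAT t ≡ true
  isDAT-true = ∧-intro isForest-true (all-intro _ (allVtx n k) (λ v → all-intro _ (upTo (nV n k)) (descVal-true v)))

isDAT≡grandparentsOK : ∀ {n k} (t : ParentData n k) → isDAT t ≡ grandparentsOK t
isDAT≡grandparentsOK t = bool-ext (isDAT⇒grandparentsOK t) (GrandparentsOK.isDAT-true t)

-- Contracting the blue vertex 1

-- For the parent vector of the red vertices: the number of red children of 0^b.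
zeros : ∀ {m n} → Vec (Fin (suc m)) n → ℕ
zeros [] = 0
zeros (zero ∷ v) = suc (zeros v)
zeros (suc _ ∷ v) = zeros v

zeros≤length : ∀ {m n} (v : Vec (Fin (suc m)) n) → zeros v ≤ n
zeros≤length [] = z≤n
zeros≤length (zero ∷ v) = s≤s (zeros≤length v)
zeros≤length (suc _ ∷ v) = m≤n⇒m≤1+n (zeros≤length v)

-- Deleting 1^b and attaching its red children to 0^b: in the parent vector of the red vertices,
-- blue 1 becomes blue 0 and blue j + 2 becomes blue j + 1.
mergeOne : ∀ {k} → Fin (suc (suc k)) → Fin (suc k)
mergeOne zero = zero
mergeOne (suc zero) = zero
mergeOne (suc (suc j)) = suc j

isZero : ∀ {m} → Fin m → Bool
isZero zero = true
isZero (suc _) = false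

isOne : ∀ {m} → Fin m → Bool
isOne (suc zero) = true
isOne _ = false

-- The grandparent conditions that involve 1^b when its parent is i0^r: the red vertices
-- 1, …, i0 − 1 are not children of 1^b and, if i0 ≠ 0, i0^r is a child of 0^b.
blueOneOK : ∀ {n k} → Fin (suc n) → Vec (Fin (suc (suc k))) n → Bool
blueOneOK zero _ = true
blueOneOK (suc zero) (u ∷ pr) = isZero u
blueOneOK (suc (suc i)) (u ∷ pr) = not (isOne u) ∧ blueOneOK (suc i) pr

-- Whether 1^b is a non-leaf child of 0^r, i.e. contributes to w^ch.
blueOneWeight : ∀ {n k} → Fin (suc n) → Vec (Fin (suc (suc k))) n → Bool
blueOneWeight {n} i0 pr = isZero i0 ∧ anyF n (λ i → isOne (lookup pr i))

blueOneTerm : ∀ {n k} → ℕ → ℕ → Vec (Fin (suc (suc k))) n → Fin (suc n) → ℕ → ℕ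
blueOneTerm s m pr i0 w = ⟦ blueOneOK i0 pr ⟧ * (⟦ ⟦ blueOneWeight i0 pr ⟧ + w ≡ᵇ m ⟧ * ⟦ zeros pr ≡ᵇ s ⟧)

blueOneOKAt : ∀ {n k} → Fin (suc n) → Fin n → Fin (suc (suc k)) → Bool
blueOneOKAt i0 i zero = true
blueOneOKAt i0 i (suc zero) = toℕ i0 ≤ᵇ toℕ i
blueOneOKAt i0 i (suc (suc _)) = true

blueOneOK′ : ∀ {n k} → Fin (suc n) → Vec (Fin (suc (suc k))) n → Bool
blueOneOK′ {n} i0 pr = allF n (λ i → blueOneOKAt i0 i (lookup pr i)) ∧ blueOK pr zero i0

isZero-isOne : ∀ {k} (u : Fin (suc (suc k))) → isZero u ≡ not (isOne u) ∧ (toℕ u ≤ᵇ 0)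
isZero-isOne zero = refl
isZero-isOne (suc zero) = refl
isZero-isOne (suc (suc u)) = refl

blueOneOK′≡blueOneOK : ∀ {n k} (i0 : Fin (suc n)) (pr : Vec (Fin (suc (suc k))) n) → blueOneOK′ i0 pr ≡ blueOneOK i0 pr
blueOneOK′≡blueOneOK {n} zero pr = trans (∧-identityʳ _) (allF-true n _ (λ i → holds (lookup pr i))) where
  holds : ∀ {k} {i : Fin n} (v : Fin (suc (suc k))) → blueOneOKAt {n} zero i v ≡ true
  holds zero = refl
  holds (suc zero) = refl
  holds (suc (suc v)) = refl
blueOneOK′≡blueOneOK {suc n} (suc zero) (u ∷ pr) = trans (cong (λ b → (blueOneOKAt (suc zero) zero u ∧ b) ∧ (toℕ u ≤ᵇ 0)) (allF-true n _ (λ i → holds (lookup pr i))))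
  (trans (first u) (sym (isZero-isOne u))) where
  holds : ∀ {k} {i : Fin n} (v : Fin (suc (suc k))) → blueOneOKAt {suc n} (suc zero) (suc i) v ≡ true
  holds zero = refl
  holds (suc zero) = refl
  holds (suc (suc v)) = refl
  first : ∀ {k} (u : Fin (suc (suc k))) → (blueOneOKAt {suc n} (suc zero) zero u ∧ true) ∧ (toℕ u ≤ᵇ 0) ≡ not (isOne u) ∧ (toℕ u ≤ᵇ 0)
  first zero = refl
  first (suc zero) = refl
  first (suc (suc u)) = refl
blueOneOK′≡blueOneOK {suc n} (suc (suc i)) (u ∷ pr) = trans (∧-assoc (blueOneOKAt (suc (suc i)) zero u) (allF n (λ i′ → blueOneOKAt (suc (suc i)) (suc i′) (lookup pr i′))) (blueOK pr zero (suc i)))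
  (cong₂ _∧_ (first u) (trans (cong (λ b → b ∧ blueOK pr zero (suc i)) (allF-cong n (λ j → shifted (lookup pr j)))) (blueOneOK′≡blueOneOK (suc i) pr))) where
  first : ∀ {k} (u : Fin (suc (suc k))) → blueOneOKAt {suc n} (suc (suc i)) zero u ≡ not (isOne u)
  first zero = refl
  first (suc zero) = refl
  first (suc (suc u)) = refl
  shifted : ∀ {k} {j : Fin n} (v : Fin (suc (suc k))) → blueOneOKAt (suc (suc i)) (suc j) v ≡ blueOneOKAt (suc i) j v
  shifted zero = refl
  shifted (suc zero) = refl
  shifted (suc (suc v)) = refl

redOK-mergeOne : ∀ {n k} (i0 : Fin (suc n)) (pbt : Vec (Fin (suc n)) k) (i : Fin n) (v : Fin (suc (suc k))) →
  redOK (i0 ∷ pbt) i v ≡ redOK pbt i (mergeOne v) ∧ blueOneOKAt i0 i v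
redOK-mergeOne i0 pbt i zero = refl
redOK-mergeOne i0 pbt i (suc zero) = refl
redOK-mergeOne i0 pbt i (suc (suc j)) = sym (∧-identityʳ _)

≤ᵇ-mergeOne : ∀ {k} (v : Fin (suc (suc k))) t → (toℕ v ≤ᵇ suc t) ≡ (toℕ (mergeOne v) ≤ᵇ t)
≤ᵇ-mergeOne zero t = refl
≤ᵇ-mergeOne (suc zero) t = refl
≤ᵇ-mergeOne (suc (suc v)) t = refl

blueOK-mergeOne : ∀ {n k} (pr : Vec (Fin (suc (suc k))) n) (j : Fin k) (u : Fin (suc n)) →
  blueOK pr (suc j) u ≡ blueOK (V.map mergeOne pr) j u
blueOK-mergeOne pr j zero = refl
blueOK-mergeOne pr j (suc i) = trans (≤ᵇ-mergeOne (lookup pr i) (toℕ j)) (cong (λ z → toℕ z ≤ᵇ toℕ j) (sym (lookup-map i mergeOne pr)))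

grandparentsOK-∷ : ∀ {n k} (pr : Vec (Fin (suc (suc k))) n) (i0 : Fin (suc n)) (pbt : Vec (Fin (suc n)) k) →
  grandparentsOK (pr , i0 ∷ pbt) ≡ grandparentsOK (V.map mergeOne pr , pbt) ∧ blueOneOK i0 pr
grandparentsOK-∷ {n} {k} pr i0 pbt = begin
  allF n (λ i → redOK (i0 ∷ pbt) i (lookup pr i)) ∧ (blueOK pr zero i0 ∧ allF k (λ j → blueOK pr (suc j) (lookup pbt j)))
    ≡⟨ cong₂ (λ a b → a ∧ (blueOK pr zero i0 ∧ b))
         (trans (allF-cong n (λ i → redOK-mergeOne i0 pbt i (lookup pr i))) (allF-∧ n _ _))
         (allF-cong k (λ j → blueOK-mergeOne pr j (lookup pbt j))) ⟩
  (allF n (λ i → redOK pbt i (mergeOne (lookup pr i))) ∧ allF n (λ i → blueOneOKAt i0 i (lookup pr i))) ∧ (blueOK pr zero i0 ∧ allF k (λ j → blueOK prM j (lookup pbt j)))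
    ≡⟨ cong (λ a → (a ∧ allF n (λ i → blueOneOKAt i0 i (lookup pr i))) ∧ (blueOK pr zero i0 ∧ allF k (λ j → blueOK prM j (lookup pbt j))))
         (allF-cong n (λ i → cong (redOK pbt i) (sym (lookup-map i mergeOne pr)))) ⟩
  (a ∧ b) ∧ (c ∧ d)
    ≡⟨ rearr a b c d ⟩
  (a ∧ d) ∧ (b ∧ c)
    ≡⟨ cong ((a ∧ d) ∧_) (blueOneOK′≡blueOneOK i0 pr) ⟩
  grandparentsOK (prM , pbt) ∧ blueOneOK i0 pr ∎
  where
  open ≡-Reasoning
  prM = V.map mergeOne pr
  a = allF n (λ i → redOK pbt i (lookup prM i))
  b = allF n (λ i → blueOneOKAt i0 i (lookup pr i))
  c = blueOK pr zero i0
  d = allF k (λ j → blueOK prM j (lookup pbt j))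
  rearr : ∀ a b c d → (a ∧ b) ∧ (c ∧ d) ≡ (a ∧ d) ∧ (b ∧ c)
  rearr true true true true = refl
  rearr true true true false = refl
  rearr true true false true = refl
  rearr true true false false = refl
  rearr true false c true = refl
  rearr true false c false = refl
  rearr false b c d = refl

≡ᶠ-mergeOne : ∀ {k} (v : Fin (suc (suc k))) (j : Fin k) → (v ≡ᶠ suc (suc j)) ≡ (mergeOne v ≡ᶠ suc j)
≡ᶠ-mergeOne zero j = refl
≡ᶠ-mergeOne (suc zero) j = refl
≡ᶠ-mergeOne (suc (suc v)) j = refl

≡ᶠ-one : ∀ {k} (v : Fin (suc (suc k))) → (v ≡ᶠ suc zero) ≡ isOne v
≡ᶠ-one zero = refl
≡ᶠ-one (suc zero) = refl
≡ᶠ-one (suc (suc v)) = refl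

≡ᶠ-zero : ∀ {m} (v : Fin (suc m)) → (v ≡ᶠ zero) ≡ isZero v
≡ᶠ-zero zero = refl
≡ᶠ-zero (suc v) = refl

wch′-∷ : ∀ {n k} (pr : Vec (Fin (suc (suc k))) n) (i0 : Fin (suc n)) (pbt : Vec (Fin (suc n)) k) →
  wch′ (pr , i0 ∷ pbt) ≡ ⟦ blueOneWeight i0 pr ⟧ + wch′ (V.map mergeOne pr , pbt)
wch′-∷ {n} {k} pr i0 pbt = cong₂ _+_
  (cong₂ (λ a b → ⟦ a ∧ b ⟧) (≡ᶠ-zero i0) (anyF-cong n (λ i → ≡ᶠ-one (lookup pr i))))
  (sumF-cong k (λ j → cong (λ b → ⟦ (lookup pbt j ≡ᶠ zero) ∧ b ⟧)
     (anyF-cong n (λ i → trans (≡ᶠ-mergeOne (lookup pr i) j) (cong (_≡ᶠ suc j) (sym (lookup-map i mergeOne pr)))))))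

-- The sum of f over the preimages of v under V.map mergeOne.
sumFibre : ∀ {k n} → (Vec (Fin (suc (suc k))) n → ℕ) → Vec (Fin (suc k)) n → ℕ
sumFibre f [] = f []
sumFibre f (zero ∷ v) = sumFibre (λ pr → f (zero ∷ pr)) v + sumFibre (λ pr → f (suc zero ∷ pr)) v
sumFibre f (suc j ∷ v) = sumFibre (λ pr → f (suc (suc j) ∷ pr)) v

sumFibre-ext : ∀ {k n} (v : Vec (Fin (suc k)) n) (f g : Vec (Fin (suc (suc k))) n → ℕ) →
  (∀ pr → V.map mergeOne pr ≡ v → f pr ≡ g pr) → sumFibre f v ≡ sumFibre g v
sumFibre-ext [] f g e = e [] refl
sumFibre-ext (zero ∷ v) f g e = cong₂ _+_
  (sumFibre-ext v _ _ (λ pr eq → e (zero ∷ pr) (cong (zero ∷_) eq)))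
  (sumFibre-ext v _ _ (λ pr eq → e (suc zero ∷ pr) (cong (zero ∷_) eq)))
sumFibre-ext (suc j ∷ v) f g e = sumFibre-ext v _ _ (λ pr eq → e (suc (suc j) ∷ pr) (cong (suc j ∷_) eq))

sumFibre-cong : ∀ {k n} (v : Vec (Fin (suc k)) n) {f g : Vec (Fin (suc (suc k))) n → ℕ} →
  (∀ pr → f pr ≡ g pr) → sumFibre f v ≡ sumFibre g v
sumFibre-cong v {f} {g} e = sumFibre-ext v f g (λ pr _ → e pr)

sumFibre-zero : ∀ {k n} (v : Vec (Fin (suc k)) n) → sumFibre {k} (λ _ → 0) v ≡ 0
sumFibre-zero [] = refl
sumFibre-zero (zero ∷ v) = cong₂ _+_ (sumFibre-zero v) (sumFibre-zero v)
sumFibre-zero (suc j ∷ v) = sumFibre-zero v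

sumFibre-+ : ∀ {k n} (v : Vec (Fin (suc k)) n) (f g : Vec (Fin (suc (suc k))) n → ℕ) →
  sumFibre (λ pr → f pr + g pr) v ≡ sumFibre f v + sumFibre g v
sumFibre-+ [] f g = refl
sumFibre-+ (zero ∷ v) f g rewrite sumFibre-+ v (λ pr → f (zero ∷ pr)) (λ pr → g (zero ∷ pr))
                              | sumFibre-+ v (λ pr → f (suc zero ∷ pr)) (λ pr → g (suc zero ∷ pr)) =
  ring (sumFibre (λ pr → f (zero ∷ pr)) v) (sumFibre (λ pr → g (zero ∷ pr)) v) (sumFibre (λ pr → f (suc zero ∷ pr)) v) (sumFibre (λ pr → g (suc zero ∷ pr)) v) where
  ring : ∀ a b c d → a + b + (c + d) ≡ a + c + (b + d)
  ring = solve-∀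
sumFibre-+ (suc j ∷ v) f g = sumFibre-+ v _ _

sumFibre-* : ∀ {k n} (v : Vec (Fin (suc k)) n) c (f : Vec (Fin (suc (suc k))) n → ℕ) →
  sumFibre (λ pr → c * f pr) v ≡ c * sumFibre f v
sumFibre-* [] c f = refl
sumFibre-* (zero ∷ v) c f rewrite sumFibre-* v c (λ pr → f (zero ∷ pr)) | sumFibre-* v c (λ pr → f (suc zero ∷ pr)) =
  sym (*-distribˡ-+ c _ _)
sumFibre-* (suc j ∷ v) c f = sumFibre-* v c _

sumFibre-sumL : ∀ {k n} {B : Set} (v : Vec (Fin (suc k)) n) (h : Vec (Fin (suc (suc k))) n → B → ℕ) (ys : List B) →
  sumFibre (λ pr → sumL (h pr) ys) v ≡ sumL (λ y → sumFibre (λ pr → h pr y) v) ys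
sumFibre-sumL v h [] = sumFibre-zero v
sumFibre-sumL v h (y ∷ ys) = trans (sumFibre-+ v (λ pr → h pr y) (λ pr → sumL (h pr) ys))
  (cong (sumFibre (λ pr → h pr y) v +_) (sumFibre-sumL v h ys))

sumL-byFibres : ∀ {k} n (f : Vec (Fin (suc (suc k))) n → ℕ) →
  sumL f (allVec (allFin (suc (suc k))) n) ≡ sumL (sumFibre f) (allVec (allFin (suc k)) n)
sumL-byFibres zero f = refl
sumL-byFibres {k} (suc n) f = begin
  sumL f (allVec A2 (suc n))
    ≡⟨ sumL-allVec-suc A2 n f ⟩
  sumL (λ x → sumL (λ v → f (x ∷ v)) (allVec A2 n)) A2
    ≡⟨ sumL-cong A2 (λ x → sumL-byFibres n (λ v → f (x ∷ v))) ⟩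
  sumL (λ x → sumL (sumFibre (λ v → f (x ∷ v))) L1) A2
    ≡⟨ sumL-allFin (suc (suc k)) (λ x → sumL (sumFibre (λ v → f (x ∷ v))) L1) ⟩
  a0 + (a1 + sumF k (λ j → sumL (sumFibre (λ v → f (suc (suc j) ∷ v))) L1))
    ≡⟨ sym (+-assoc a0 a1 _) ⟩
  (a0 + a1) + sumF k (λ j → sumL (sumFibre (λ v → f (suc (suc j) ∷ v))) L1)
    ≡⟨ cong (_+ sumF k (λ j → sumL (sumFibre (λ v → f (suc (suc j) ∷ v))) L1))
         (sym (sumL-+ (sumFibre (λ v → f (zero ∷ v))) (sumFibre (λ v → f (suc zero ∷ v))) L1)) ⟩
  sumF (suc k) (λ y → sumL (λ v → sumFibre f (y ∷ v)) L1)
    ≡⟨ sym (sumL-allFin (suc k) (λ y → sumL (λ v → sumFibre f (y ∷ v)) L1)) ⟩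
  sumL (λ y → sumL (λ v → sumFibre f (y ∷ v)) L1) (allFin (suc k))
    ≡⟨ sym (sumL-allVec-suc (allFin (suc k)) n (sumFibre f)) ⟩
  sumL (sumFibre f) (allVec (allFin (suc k)) (suc n)) ∎
  where
  open ≡-Reasoning
  A2 = allFin (suc (suc k))
  L1 = allVec (allFin (suc k)) n
  a0 = sumL (sumFibre (λ v → f (zero ∷ v))) L1
  a1 = sumL (sumFibre (λ v → f (suc zero ∷ v))) L1

ones : ∀ {k n} → Vec (Fin (suc (suc k))) n → ℕ
ones [] = 0
ones (suc zero ∷ v) = suc (ones v)
ones (zero ∷ v) = ones v
ones (suc (suc _) ∷ v) = ones v

zeros-mergeOne : ∀ {k n} (pr : Vec (Fin (suc (suc k))) n) → zeros (V.map mergeOne pr) ≡ zeros pr + ones pr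
zeros-mergeOne [] = refl
zeros-mergeOne (zero ∷ pr) = cong suc (zeros-mergeOne pr)
zeros-mergeOne (suc zero ∷ pr) = trans (cong suc (zeros-mergeOne pr)) (sym (+-suc _ _))
zeros-mergeOne (suc (suc j) ∷ pr) = zeros-mergeOne pr

anyOne≡ones : ∀ {k n} (pr : Vec (Fin (suc (suc k))) n) → anyF n (λ i → isOne (lookup pr i)) ≡ not (ones pr ≡ᵇ 0)
anyOne≡ones [] = refl
anyOne≡ones (zero ∷ pr) = anyOne≡ones pr
anyOne≡ones (suc zero ∷ pr) = refl
anyOne≡ones (suc (suc j) ∷ pr) = anyOne≡ones pr

sumFibre-zeros : ∀ {k n} (v : Vec (Fin (suc k)) n) s → sumFibre (λ pr → ⟦ zeros pr ≡ᵇ s ⟧) v ≡ (zeros v C s)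
sumFibre-zeros [] zero = refl
sumFibre-zeros [] (suc s) = refl
sumFibre-zeros (zero ∷ v) zero = cong₂ _+_ (trans (sumFibre-cong v (λ pr → refl)) (sumFibre-zero v)) (sumFibre-zeros v 0)
sumFibre-zeros (zero ∷ v) (suc s) =
  trans (cong₂ _+_ (sumFibre-zeros v s) (sumFibre-zeros v (suc s))) (nCk+nC[k+1]≡[n+1]C[k+1] (zeros v) s)
sumFibre-zeros (suc j ∷ v) s = sumFibre-zeros v s

rootCase-coeff : ∀ r s w m → ⟦ ⟦ not (s ≡ᵇ r) ⟧ + w ≡ᵇ m ⟧ * (r C s) ≡ ⟦ s ≡ᵇ r ⟧ * ⟦ w ≡ᵇ m ⟧ + T₁ r s * ⟦ suc w ≡ᵇ m ⟧
rootCase-coeff r s w m with <-cmp s r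
... | tri< lt _ _ rewrite ≢⇒≡ᵇ≡false s r (<⇒≢ lt) | <⇒<ᵇ≡true s r lt = ring (⟦ suc w ≡ᵇ m ⟧) (r C s) where
  ring : ∀ x b → x * b ≡ 0 + (b + 0) * x
  ring = solve-∀
... | tri≈ _ refl _ rewrite ≡ᵇ-refl s | ≥⇒<ᵇ≡false s s ≤-refl | nCn≡1 s = trans (*-identityʳ _) (sym (trans (+-identityʳ _) (+-identityʳ _)))
... | tri> _ _ gt rewrite ≢⇒≡ᵇ≡false s r (λ e → <⇒≢ gt (sym e)) | ≥⇒<ᵇ≡false s r (<⇒≤ gt) | k>n⇒nCk≡0 gt = *-zeroʳ ⟦ suc w ≡ᵇ m ⟧

sumFibre-rootCase : ∀ {k n} (v : Vec (Fin (suc k)) n) w m s →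
  sumFibre (λ pr → ⟦ ⟦ blueOneWeight zero pr ⟧ + w ≡ᵇ m ⟧ * ⟦ zeros pr ≡ᵇ s ⟧) v ≡ ⟦ s ≡ᵇ zeros v ⟧ * ⟦ w ≡ᵇ m ⟧ + T₁ (zeros v) s * ⟦ suc w ≡ᵇ m ⟧
sumFibre-rootCase {k} {n} v w m s = begin
  sumFibre (λ pr → ⟦ ⟦ blueOneWeight zero pr ⟧ + w ≡ᵇ m ⟧ * ⟦ zeros pr ≡ᵇ s ⟧) v
    ≡⟨ sumFibre-ext v (λ pr → ⟦ ⟦ blueOneWeight zero pr ⟧ + w ≡ᵇ m ⟧ * ⟦ zeros pr ≡ᵇ s ⟧) (λ pr → ⟦ ⟦ not (s ≡ᵇ zeros v) ⟧ + w ≡ᵇ m ⟧ * ⟦ zeros pr ≡ᵇ s ⟧) step ⟩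
  sumFibre (λ pr → ⟦ ⟦ not (s ≡ᵇ zeros v) ⟧ + w ≡ᵇ m ⟧ * ⟦ zeros pr ≡ᵇ s ⟧) v
    ≡⟨ sumFibre-* v ⟦ ⟦ not (s ≡ᵇ zeros v) ⟧ + w ≡ᵇ m ⟧ (λ pr → ⟦ zeros pr ≡ᵇ s ⟧) ⟩
  ⟦ ⟦ not (s ≡ᵇ zeros v) ⟧ + w ≡ᵇ m ⟧ * sumFibre (λ pr → ⟦ zeros pr ≡ᵇ s ⟧) v
    ≡⟨ cong (⟦ ⟦ not (s ≡ᵇ zeros v) ⟧ + w ≡ᵇ m ⟧ *_) (sumFibre-zeros v s) ⟩
  ⟦ ⟦ not (s ≡ᵇ zeros v) ⟧ + w ≡ᵇ m ⟧ * (zeros v C s)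
    ≡⟨ rootCase-coeff (zeros v) s w m ⟩
  ⟦ s ≡ᵇ zeros v ⟧ * ⟦ w ≡ᵇ m ⟧ + T₁ (zeros v) s * ⟦ suc w ≡ᵇ m ⟧ ∎
  where
  open ≡-Reasoning
  step : ∀ pr → V.map mergeOne pr ≡ v → ⟦ ⟦ blueOneWeight zero pr ⟧ + w ≡ᵇ m ⟧ * ⟦ zeros pr ≡ᵇ s ⟧ ≡ ⟦ ⟦ not (s ≡ᵇ zeros v) ⟧ + w ≡ᵇ m ⟧ * ⟦ zeros pr ≡ᵇ s ⟧
  step pr refl = begin
    ⟦ ⟦ anyF n (λ i → isOne (lookup pr i)) ⟧ + w ≡ᵇ m ⟧ * ⟦ zeros pr ≡ᵇ s ⟧
      ≡⟨ cong (λ b → ⟦ ⟦ b ⟧ + w ≡ᵇ m ⟧ * ⟦ zeros pr ≡ᵇ s ⟧)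
           (trans (anyOne≡ones pr) (cong not (trans (sym (≡ᵇ-+ʳ (zeros pr) (ones pr))) (cong (zeros pr ≡ᵇ_) (sym (zeros-mergeOne pr)))))) ⟩
    ⟦ ⟦ not (zeros pr ≡ᵇ zeros (V.map mergeOne pr)) ⟧ + w ≡ᵇ m ⟧ * ⟦ zeros pr ≡ᵇ s ⟧
      ≡⟨ ⟦≡ᵇ⟧-subst (zeros pr) s (λ a → ⟦ ⟦ not (a ≡ᵇ zeros (V.map mergeOne pr)) ⟧ + w ≡ᵇ m ⟧) ⟩
    ⟦ ⟦ not (s ≡ᵇ zeros (V.map mergeOne pr)) ⟧ + w ≡ᵇ m ⟧ * ⟦ zeros pr ≡ᵇ s ⟧ ∎

pascal-truncated : ∀ r s → (r C s) + ⟦ s ≤ᵇ r ⟧ * binm1 r s ≡ ⟦ s <ᵇ suc r ⟧ * (suc r C s)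
pascal-truncated r zero = refl
pascal-truncated r (suc s) with s <? r
... | yes lt = begin
  r C suc s + ⟦ s <ᵇ r ⟧ * (r C s)  ≡⟨ cong (λ b → r C suc s + ⟦ b ⟧ * (r C s)) s<ᵇr ⟩
  r C suc s + 1 * (r C s)           ≡⟨ cong (r C suc s +_) (*-identityˡ _) ⟩
  r C suc s + r C s                 ≡⟨ +-comm (r C suc s) (r C s) ⟩
  r C s + r C suc s                 ≡⟨ nCk+nC[k+1]≡[n+1]C[k+1] r s ⟩
  suc r C suc s                     ≡⟨ sym (*-identityˡ _) ⟩
  1 * (suc r C suc s)               ≡⟨ cong (λ b → ⟦ b ⟧ * (suc r C suc s)) (sym s<ᵇr) ⟩
  ⟦ s <ᵇ r ⟧ * (suc r C suc s)      ∎
  where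
  open ≡-Reasoning
  s<ᵇr = <⇒<ᵇ≡true s r lt
... | no s≮r = trans (cong₂ (λ a b → a + ⟦ b ⟧ * (r C s)) (k>n⇒nCk≡0 (s≤s (≮⇒≥ s≮r))) s≮ᵇr)
                    (cong (λ b → ⟦ b ⟧ * (suc r C suc s)) (sym s≮ᵇr))
  where s≮ᵇr = ≥⇒<ᵇ≡false s r (≮⇒≥ s≮r)

sumFibre-innerCase : ∀ {k n} (v : Vec (Fin (suc k)) n) s →
  sumFibre (λ pr → sumF n (λ i → ⟦ blueOneOK (suc i) pr ⟧ * ⟦ zeros pr ≡ᵇ s ⟧)) v ≡ ⟦ s ≤ᵇ zeros v ⟧ * binm1 (zeros v) s
sumFibre-innerCase [] zero = refl
sumFibre-innerCase [] (suc s) = refl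
sumFibre-innerCase {k} {suc n} (zero ∷ v) zero = begin
  sumFibre (λ pr → 1 * 0 + sumF n (λ i → ⟦ blueOneOK (suc i) pr ⟧ * 0)) v + sumFibre (λ pr → 0 + sumF n (λ i → 0 * ⟦ zeros pr ≡ᵇ 0 ⟧)) v
    ≡⟨ cong₂ _+_ (trans (sumFibre-cong v (λ pr → sumF-zero n _ (λ i → *-zeroʳ ⟦ blueOneOK (suc i) pr ⟧))) (sumFibre-zero v))
                 (trans (sumFibre-cong v (λ pr → sumF-zero n _ (λ i → refl))) (sumFibre-zero v)) ⟩
  0 ∎
  where open ≡-Reasoning
sumFibre-innerCase {k} {suc n} (zero ∷ v) (suc s) = begin
  sumFibre (λ pr → 1 * ⟦ zeros pr ≡ᵇ s ⟧ + sumF n (λ i → ⟦ blueOneOK (suc i) pr ⟧ * ⟦ zeros pr ≡ᵇ s ⟧)) v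
    + sumFibre (λ pr → 0 + sumF n (λ i → 0 * ⟦ zeros pr ≡ᵇ suc s ⟧)) v
    ≡⟨ cong₂ _+_ (sumFibre-+ v (λ pr → 1 * ⟦ zeros pr ≡ᵇ s ⟧) (λ pr → sumF n (λ i → ⟦ blueOneOK (suc i) pr ⟧ * ⟦ zeros pr ≡ᵇ s ⟧)))
                 (trans (sumFibre-cong v (λ pr → sumF-zero n _ (λ i → refl))) (sumFibre-zero v)) ⟩
  (sumFibre (λ pr → 1 * ⟦ zeros pr ≡ᵇ s ⟧) v + sumFibre (λ pr → sumF n (λ i → ⟦ blueOneOK (suc i) pr ⟧ * ⟦ zeros pr ≡ᵇ s ⟧)) v) + 0
    ≡⟨ cong₂ (λ a b → (a + b) + 0) (trans (sumFibre-cong v (λ pr → *-identityˡ _)) (sumFibre-zeros v s)) (sumFibre-innerCase v s) ⟩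
  ((zeros v C s) + ⟦ s ≤ᵇ zeros v ⟧ * binm1 (zeros v) s) + 0
    ≡⟨ trans (+-identityʳ _) (pascal-truncated (zeros v) s) ⟩
  ⟦ s <ᵇ suc (zeros v) ⟧ * (suc (zeros v) C s) ∎
  where open ≡-Reasoning
sumFibre-innerCase {k} {suc n} (suc j ∷ v) s = sumFibre-innerCase v s

sumFibre-transfer : ∀ {k n} (v : Vec (Fin (suc k)) n) w m s →
  sumFibre (λ pr → sumF (suc n) (λ i0 → blueOneTerm s m pr i0 w)) v
  ≡ T₀ (zeros v) s * ⟦ w ≡ᵇ m ⟧ + T₁ (zeros v) s * ⟦ suc w ≡ᵇ m ⟧
sumFibre-transfer {k} {n} v w m s = begin
  sumFibre (λ pr → sumF (suc n) (λ i0 → ⟦ blueOneOK i0 pr ⟧ * (⟦ ⟦ blueOneWeight i0 pr ⟧ + w ≡ᵇ m ⟧ * ⟦ zeros pr ≡ᵇ s ⟧))) v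
    ≡⟨ sumFibre-cong v (λ pr → cong₂ _+_ (*-identityˡ _)
         (trans (sumF-cong n (λ i → ring ⟦ blueOneOK (suc i) pr ⟧ ⟦ w ≡ᵇ m ⟧ ⟦ zeros pr ≡ᵇ s ⟧))
                (sumF-* n ⟦ w ≡ᵇ m ⟧ (λ i → ⟦ blueOneOK (suc i) pr ⟧ * ⟦ zeros pr ≡ᵇ s ⟧)))) ⟩
  sumFibre (λ pr → ⟦ ⟦ blueOneWeight zero pr ⟧ + w ≡ᵇ m ⟧ * ⟦ zeros pr ≡ᵇ s ⟧ + ⟦ w ≡ᵇ m ⟧ * sumF n (λ i → ⟦ blueOneOK (suc i) pr ⟧ * ⟦ zeros pr ≡ᵇ s ⟧)) v
    ≡⟨ sumFibre-+ v _ _ ⟩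
  sumFibre (λ pr → ⟦ ⟦ blueOneWeight zero pr ⟧ + w ≡ᵇ m ⟧ * ⟦ zeros pr ≡ᵇ s ⟧) v
    + sumFibre (λ pr → ⟦ w ≡ᵇ m ⟧ * sumF n (λ i → ⟦ blueOneOK (suc i) pr ⟧ * ⟦ zeros pr ≡ᵇ s ⟧)) v
    ≡⟨ cong₂ _+_ (sumFibre-rootCase v w m s) (trans (sumFibre-* v ⟦ w ≡ᵇ m ⟧ _) (cong (⟦ w ≡ᵇ m ⟧ *_) (sumFibre-innerCase v s))) ⟩
  (⟦ s ≡ᵇ zeros v ⟧ * ⟦ w ≡ᵇ m ⟧ + T₁ (zeros v) s * ⟦ suc w ≡ᵇ m ⟧) + ⟦ w ≡ᵇ m ⟧ * (⟦ s ≤ᵇ zeros v ⟧ * binm1 (zeros v) s)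
    ≡⟨ ring₂ ⟦ s ≡ᵇ zeros v ⟧ ⟦ w ≡ᵇ m ⟧ (T₁ (zeros v) s) ⟦ suc w ≡ᵇ m ⟧ (⟦ s ≤ᵇ zeros v ⟧ * binm1 (zeros v) s) ⟩
  T₀ (zeros v) s * ⟦ w ≡ᵇ m ⟧ + T₁ (zeros v) s * ⟦ suc w ≡ᵇ m ⟧ ∎
  where
  open ≡-Reasoning
  ring : ∀ a b c → a * (b * c) ≡ b * (a * c)
  ring = solve-∀
  ring₂ : ∀ a b c d e → (a * b + c * d) + b * e ≡ (a + e) * b + c * d
  ring₂ = solve-∀

refinedTerm : ∀ {n k} → ℕ → ℕ → ParentData n k → ℕ
refinedTerm r m t = ⟦ grandparentsOK t ⟧ * (⟦ wch′ t ≡ᵇ m ⟧ * ⟦ zeros (proj₁ t) ≡ᵇ r ⟧)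

refinedCount : ℕ → ℕ → ℕ → ℕ → ℕ
refinedCount n k r m = sumL (refinedTerm r m) (allParentData n k)

refinedTerm-∷ : ∀ {n k} s m (pr : Vec (Fin (suc (suc k))) n) i0 pbt →
  refinedTerm s m (pr , i0 ∷ pbt)
  ≡ ⟦ grandparentsOK (V.map mergeOne pr , pbt) ⟧ * blueOneTerm s m pr i0 (wch′ (V.map mergeOne pr , pbt))
refinedTerm-∷ s m pr i0 pbt = begin
  ⟦ grandparentsOK (pr , i0 ∷ pbt) ⟧ * (⟦ wch′ (pr , i0 ∷ pbt) ≡ᵇ m ⟧ * ⟦ zeros pr ≡ᵇ s ⟧)
    ≡⟨ cong₂ (λ a b → ⟦ a ⟧ * (⟦ b ≡ᵇ m ⟧ * ⟦ zeros pr ≡ᵇ s ⟧)) (grandparentsOK-∷ pr i0 pbt) (wch′-∷ pr i0 pbt) ⟩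
  ⟦ g ∧ blueOneOK i0 pr ⟧ * (⟦ ⟦ blueOneWeight i0 pr ⟧ + w ≡ᵇ m ⟧ * ⟦ zeros pr ≡ᵇ s ⟧)
    ≡⟨ cong (_* (⟦ ⟦ blueOneWeight i0 pr ⟧ + w ≡ᵇ m ⟧ * ⟦ zeros pr ≡ᵇ s ⟧)) (⟦∧⟧ g (blueOneOK i0 pr)) ⟩
  (⟦ g ⟧ * ⟦ blueOneOK i0 pr ⟧) * (⟦ ⟦ blueOneWeight i0 pr ⟧ + w ≡ᵇ m ⟧ * ⟦ zeros pr ≡ᵇ s ⟧)
    ≡⟨ *-assoc ⟦ g ⟧ _ _ ⟩
  ⟦ g ⟧ * blueOneTerm s m pr i0 w ∎
  where
  open ≡-Reasoning
  g = grandparentsOK (V.map mergeOne pr , pbt)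
  w = wch′ (V.map mergeOne pr , pbt)

transferTerm : ∀ {n k} → ℕ → ℕ → ParentData n k → ℕ
transferTerm s m t = ⟦ grandparentsOK t ⟧ * (T₀ (zeros (proj₁ t)) s * ⟦ wch′ t ≡ᵇ m ⟧ + T₁ (zeros (proj₁ t)) s * ⟦ suc (wch′ t) ≡ᵇ m ⟧)

refinedCount-suc-byContraction : ∀ n k s m → refinedCount n (suc k) s m ≡ sumL (transferTerm s m) (allParentData n k)
refinedCount-suc-byContraction n k s m = begin
  sumL (refinedTerm s m) (allParentData n (suc k))
    ≡⟨ sumL-pairs (refinedTerm s m) Reds₂ (allVec Fn (suc k)) ⟩
  sumL (λ pr → sumL (λ pb → refinedTerm s m (pr , pb)) (allVec Fn (suc k))) Reds₂
    ≡⟨ sumL-cong Reds₂ (λ pr → sumL-allVec-suc Fn k (λ pb → refinedTerm s m (pr , pb))) ⟩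
  sumL (λ pr → sumL (λ i0 → sumL (λ pbt → refinedTerm s m (pr , i0 ∷ pbt)) Blues) Fn) Reds₂
    ≡⟨ sumL-byFibres n (λ pr → sumL (λ i0 → sumL (λ pbt → refinedTerm s m (pr , i0 ∷ pbt)) Blues) Fn) ⟩
  sumL (sumFibre (λ pr → sumL (λ i0 → sumL (λ pbt → refinedTerm s m (pr , i0 ∷ pbt)) Blues) Fn)) Reds₁
    ≡⟨ sumL-cong Reds₁ fibre ⟩
  sumL (λ pr′ → sumL (λ pbt → transferTerm s m (pr′ , pbt)) Blues) Reds₁
    ≡⟨ sumL-pairs (transferTerm s m) Reds₁ Blues ⟨
  sumL (transferTerm s m) (allParentData n k) ∎
  where
  open ≡-Reasoning
  Fn = allFin (suc n)
  Reds₂ = allVec (allFin (suc (suc k))) n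
  Reds₁ = allVec (allFin (suc k)) n
  Blues = allVec (allFin (suc n)) k
  regroup : ∀ pr′ pr → V.map mergeOne pr ≡ pr′ →
    sumL (λ i0 → sumL (λ pbt → refinedTerm s m (pr , i0 ∷ pbt)) Blues) Fn
    ≡ sumL (λ pbt → ⟦ grandparentsOK (pr′ , pbt) ⟧ * sumL (λ i0 → blueOneTerm s m pr i0 (wch′ (pr′ , pbt))) Fn) Blues
  regroup pr′ pr refl = begin
    sumL (λ i0 → sumL (λ pbt → refinedTerm s m (pr , i0 ∷ pbt)) Blues) Fn
      ≡⟨ sumL-cong Fn (λ i0 → sumL-cong Blues (refinedTerm-∷ s m pr i0)) ⟩
    sumL (λ i0 → sumL (λ pbt → ⟦ grandparentsOK (pr′ , pbt) ⟧ * blueOneTerm s m pr i0 (wch′ (pr′ , pbt))) Blues) Fn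
      ≡⟨ sumL-swap _ Fn Blues ⟩
    sumL (λ pbt → sumL (λ i0 → ⟦ grandparentsOK (pr′ , pbt) ⟧ * blueOneTerm s m pr i0 (wch′ (pr′ , pbt))) Fn) Blues
      ≡⟨ sumL-cong Blues (λ pbt → sumL-* ⟦ grandparentsOK (pr′ , pbt) ⟧ _ Fn) ⟩
    sumL (λ pbt → ⟦ grandparentsOK (pr′ , pbt) ⟧ * sumL (λ i0 → blueOneTerm s m pr i0 (wch′ (pr′ , pbt))) Fn) Blues ∎
  fibre : ∀ pr′ → sumFibre (λ pr → sumL (λ i0 → sumL (λ pbt → refinedTerm s m (pr , i0 ∷ pbt)) Blues) Fn) pr′
                  ≡ sumL (λ pbt → transferTerm s m (pr′ , pbt)) Blues
  fibre pr′ = begin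
    sumFibre (λ pr → sumL (λ i0 → sumL (λ pbt → refinedTerm s m (pr , i0 ∷ pbt)) Blues) Fn) pr′
      ≡⟨ sumFibre-ext pr′ _ _ (regroup pr′) ⟩
    sumFibre (λ pr → sumL (λ pbt → ⟦ grandparentsOK (pr′ , pbt) ⟧ * sumL (λ i0 → blueOneTerm s m pr i0 (wch′ (pr′ , pbt))) Fn) Blues) pr′
      ≡⟨ sumFibre-sumL pr′ _ Blues ⟩
    sumL (λ pbt → sumFibre (λ pr → ⟦ grandparentsOK (pr′ , pbt) ⟧ * sumL (λ i0 → blueOneTerm s m pr i0 (wch′ (pr′ , pbt))) Fn) pr′) Blues
      ≡⟨ sumL-cong Blues (λ pbt → trans (sumFibre-* pr′ ⟦ grandparentsOK (pr′ , pbt) ⟧ _)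
           (cong (⟦ grandparentsOK (pr′ , pbt) ⟧ *_)
             (trans (sumFibre-cong pr′ (λ pr → sumL-allFin (suc n) (λ i0 → blueOneTerm s m pr i0 (wch′ (pr′ , pbt))))) (sumFibre-transfer pr′ (wch′ (pr′ , pbt)) m s)))) ⟩
    sumL (λ pbt → transferTerm s m (pr′ , pbt)) Blues ∎

sumL-transferTerm : ∀ n k s m →
  sumL (transferTerm s m) (allParentData n k) ≡ sumN (suc n) (λ r → mulLin (T₀ r s) (T₁ r s) (refinedCount n k r) m)
sumL-transferTerm n k s m = begin
  sumL (transferTerm s m) Trees
    ≡⟨ sumL-byValue Trees (zeros ∘ proj₁) (suc n) _ (λ t → s≤s (zeros≤length (proj₁ t))) ⟩
  sumN (suc n) (λ r → sumL (λ t → ⟦ zeros (proj₁ t) ≡ᵇ r ⟧ * transferTerm s m t) Trees)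
    ≡⟨ sumN-cong (suc n) (λ r _ → at r) ⟩
  sumN (suc n) (λ r → mulLin (T₀ r s) (T₁ r s) (refinedCount n k r) m) ∎
  where
  open ≡-Reasoning
  Trees = allParentData n k
  shifted : ∀ r m → sumL (λ t → ⟦ grandparentsOK t ⟧ * (⟦ suc (wch′ t) ≡ᵇ m ⟧ * ⟦ zeros (proj₁ t) ≡ᵇ r ⟧)) Trees ≡ shift (refinedCount n k r) m
  shifted r zero = trans (sumL-cong Trees (λ t → *-zeroʳ ⟦ grandparentsOK t ⟧)) (sumL-zero Trees)
  shifted r (suc m) = refl
  split : ∀ r t → ⟦ zeros (proj₁ t) ≡ᵇ r ⟧ * transferTerm s m t
                  ≡ T₀ r s * refinedTerm r m t + T₁ r s * (⟦ grandparentsOK t ⟧ * (⟦ suc (wch′ t) ≡ᵇ m ⟧ * ⟦ zeros (proj₁ t) ≡ᵇ r ⟧))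
  split r t = trans (*-comm ⟦ zeros (proj₁ t) ≡ᵇ r ⟧ (transferTerm s m t)) (trans
    (⟦≡ᵇ⟧-subst (zeros (proj₁ t)) r (λ z → ⟦ grandparentsOK t ⟧ * (T₀ z s * ⟦ wch′ t ≡ᵇ m ⟧ + T₁ z s * ⟦ suc (wch′ t) ≡ᵇ m ⟧)))
    (ring ⟦ grandparentsOK t ⟧ (T₀ r s) ⟦ wch′ t ≡ᵇ m ⟧ (T₁ r s) ⟦ suc (wch′ t) ≡ᵇ m ⟧ ⟦ zeros (proj₁ t) ≡ᵇ r ⟧)) where
    ring : ∀ g a x b y z → g * (a * x + b * y) * z ≡ a * (g * (x * z)) + b * (g * (y * z))
    ring = solve-∀
  at : ∀ r → sumL (λ t → ⟦ zeros (proj₁ t) ≡ᵇ r ⟧ * transferTerm s m t) Trees ≡ mulLin (T₀ r s) (T₁ r s) (refinedCount n k r) m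
  at r = trans (sumL-cong Trees (split r)) (trans (sumL-+ _ _ Trees)
    (cong₂ _+_ (sumL-* (T₀ r s) _ Trees) (trans (sumL-* (T₁ r s) _ Trees) (cong (T₁ r s *_) (shifted r m)))))

refinedCount-suc : ∀ n k s m → refinedCount n (suc k) s m ≡ sumN (suc n) (λ r → mulLin (T₀ r s) (T₁ r s) (refinedCount n k r) m)
refinedCount-suc n k s m = trans (refinedCount-suc-byContraction n k s m) (sumL-transferTerm n k s m)

sumL-allVec-Fin1 : ∀ n (g : Vec (Fin 1) n → ℕ) → sumL g (allVec (allFin 1) n) ≡ g (V.replicate n zero)
sumL-allVec-Fin1 zero g = +-identityʳ _
sumL-allVec-Fin1 (suc n) g = trans (sumL-allVec-suc (allFin 1) n g) (trans (+-identityʳ _) (sumL-allVec-Fin1 n (λ v → g (zero ∷ v))))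

zeros-replicate : ∀ {m} n → zeros {m} (V.replicate n zero) ≡ n
zeros-replicate zero = refl
zeros-replicate (suc n) = cong suc (zeros-replicate n)

grandparentsOK-replicate : ∀ n → grandparentsOK {n} {0} (V.replicate n zero , []) ≡ true
grandparentsOK-replicate n = trans (∧-identityʳ _) (allF-true n _ (λ i → cong (redOK [] i) (lookup-rep i))) where
  lookup-rep : ∀ {n} (i : Fin n) → lookup (V.replicate n (zero {0})) i ≡ zero
  lookup-rep zero = refl
  lookup-rep (suc i) = lookup-rep i

refinedCount-zero : ∀ n r m → refinedCount n 0 r m ≡ Tpow n 0 r m
refinedCount-zero n r m = begin
  refinedCount n 0 r m
    ≡⟨ sumL-pairs (refinedTerm r m) (allVec (allFin 1) n) (allVec (allFin (suc n)) 0) ⟩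
  sumL (λ pr → ⟦ grandparentsOK (pr , []) ⟧ * (⟦ wch′ (pr , []) ≡ᵇ m ⟧ * ⟦ zeros pr ≡ᵇ r ⟧) + 0) (allVec (allFin 1) n)
    ≡⟨ sumL-allVec-Fin1 n _ ⟩
  ⟦ grandparentsOK (V.replicate n zero , []) ⟧ * (⟦ 0 ≡ᵇ m ⟧ * ⟦ zeros (V.replicate n zero) ≡ᵇ r ⟧) + 0
    ≡⟨ cong₂ (λ a b → ⟦ a ⟧ * (⟦ 0 ≡ᵇ m ⟧ * ⟦ b ≡ᵇ r ⟧) + 0) (grandparentsOK-replicate n) (zeros-replicate n) ⟩
  1 * (⟦ 0 ≡ᵇ m ⟧ * ⟦ n ≡ᵇ r ⟧) + 0
    ≡⟨ cong₂ (λ a b → 1 * (⟦ a ⟧ * ⟦ b ⟧) + 0) (≡ᵇ-sym 0 m) (≡ᵇ-sym n r) ⟩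
  1 * (⟦ m ≡ᵇ 0 ⟧ * ⟦ r ≡ᵇ n ⟧) + 0
    ≡⟨ ring ⟦ m ≡ᵇ 0 ⟧ ⟦ r ≡ᵇ n ⟧ ⟩
  ⟦ r ≡ᵇ n ⟧ * ⟦ m ≡ᵇ 0 ⟧ ∎
  where
  open ≡-Reasoning
  ring : ∀ a b → 1 * (a * b) + 0 ≡ b * a
  ring = solve-∀

refinedCount≡Tpow : ∀ k n r m → refinedCount n k r m ≡ Tpow n k r m
refinedCount≡Tpow zero n r m = refinedCount-zero n r m
refinedCount≡Tpow (suc k) n s m = trans (refinedCount-suc n k s m)
  (sumN-cong (suc n) (λ r _ → mulLin-cong (T₀ r s) (T₁ r s) (λ m' → refinedCount≡Tpow k n r m') m))

localCount : ℕ → ℕ → ℕ → ℕ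
localCount n k m = countB (λ t → grandparentsOK t ∧ (wch′ t ≡ᵇ m)) (allParentData n k)

localCount≡Trow : ∀ n k m → localCount n k m ≡ Trow n k m
localCount≡Trow n k m = begin
  localCount n k m
    ≡⟨ countB≡sumL _ (allParentData n k) ⟩
  sumL (λ t → ⟦ grandparentsOK t ∧ (wch′ t ≡ᵇ m) ⟧) (allParentData n k)
    ≡⟨ sumL-byValue (allParentData n k) (zeros ∘ proj₁) (suc n) _ (λ t → s≤s (zeros≤length (proj₁ t))) ⟩
  sumN (suc n) (λ r → sumL (λ t → ⟦ zeros (proj₁ t) ≡ᵇ r ⟧ * ⟦ grandparentsOK t ∧ (wch′ t ≡ᵇ m) ⟧) (allParentData n k))
    ≡⟨ sumN-cong (suc n) (λ r _ → trans (sumL-cong (allParentData n k) (reorder r)) (refinedCount≡Tpow k n r m)) ⟩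
  Trow n k m ∎
  where
  open ≡-Reasoning
  reorder : ∀ r t → ⟦ zeros (proj₁ t) ≡ᵇ r ⟧ * ⟦ grandparentsOK t ∧ (wch′ t ≡ᵇ m) ⟧
                    ≡ ⟦ grandparentsOK t ⟧ * (⟦ wch′ t ≡ᵇ m ⟧ * ⟦ zeros (proj₁ t) ≡ᵇ r ⟧)
  reorder r t rewrite ⟦∧⟧ (grandparentsOK t) (wch′ t ≡ᵇ m) = ring ⟦ zeros (proj₁ t) ≡ᵇ r ⟧ ⟦ grandparentsOK t ⟧ ⟦ wch′ t ≡ᵇ m ⟧ where
    ring : ∀ a b c → a * (b * c) ≡ b * (c * a)
    ring = solve-∀

-- Packed alternative tableaux

opposite-< : ∀ {n} (a b : Fin (suc n)) → toℕ a < toℕ b → toℕ (opposite b) < toℕ (opposite a)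
opposite-< {n} a b lt rewrite opposite-prop a | opposite-prop b = ∸-monoʳ-< lt (≤-pred (toℕ<n b))

opposite-fromℕ : ∀ n → opposite (fromℕ n) ≡ zero
opposite-fromℕ n = opposite-involutive {suc n} zero

≡ᵇ-bottom : ∀ {n} (r : Fin (suc n)) → (toℕ r ≡ᵇ n) ≡ isZero (opposite r)
≡ᵇ-bottom {n} r = bool-ext to from where
  to : (toℕ r ≡ᵇ n) ≡ true → isZero (opposite r) ≡ true
  to e = subst (λ z → isZero (opposite z) ≡ true)
    (sym (toℕ-injective (trans (≡ᵇ≡true⇒≡ (toℕ r) n e) (sym (toℕ-fromℕ n))))) (cong isZero (opposite-fromℕ n))
  isZero⇒≡zero : ∀ {m} (x : Fin (suc m)) → isZero x ≡ true → x ≡ zero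
  isZero⇒≡zero zero _ = refl
  from : isZero (opposite r) ≡ true → (toℕ r ≡ᵇ n) ≡ true
  from e = subst (λ z → (toℕ z ≡ᵇ n) ≡ true) (trans (sym (cong opposite (isZero⇒≡zero (opposite r) e))) (opposite-involutive r))
    (subst (λ z → (z ≡ᵇ n) ≡ true) (sym (toℕ-fromℕ n)) (≡ᵇ-refl n))

module _ {n k : ℕ} (g : Grid n k) where
  rowQ : Fin (suc n) → Bool
  rowQ r = sumF (suc k) (λ c → ⟦ isL (cell g r c) ⟧) ≡ᵇ (if toℕ r ≡ᵇ n then 0 else 1)
  colQ : Fin (suc k) → Bool
  colQ c = sumF (suc n) (λ r → ⟦ isD (cell g r c) ⟧) ≡ᵇ (if toℕ c ≡ᵇ 0 then 0 else 1)
  ptLQ : Fin (suc n) → Fin (suc k) → Fin (suc k) → Bool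
  ptLQ r c c' = not (toℕ c' <ᵇ toℕ c) ∨ isE (cell g r c')
  ptDQ : Fin (suc n) → Fin (suc k) → Fin (suc n) → Bool
  ptDQ r c r' = not (toℕ r <ᵇ toℕ r') ∨ isE (cell g r' c)
  ptQ : Fin (suc n) → Fin (suc k) → Bool
  ptQ r c = (not (isL (cell g r c)) ∨ allF (suc k) (ptLQ r c)) ∧ (not (isD (cell g r c)) ∨ allF (suc n) (ptDQ r c))
  rowsB colsB ptB : Bool
  rowsB = allF (suc n) rowQ
  colsB = allF (suc k) colQ
  ptB = allF (suc n) (λ r → allF (suc k) (ptQ r))

  rowP : Fin (suc n) → Bool
  rowP r = countB (λ c → isL (cell g r c)) (allFin (suc k)) ≡ᵇ (if toℕ r ≡ᵇ n then 0 else 1)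
  colP : Fin (suc k) → Bool
  colP c = countB (λ r → isD (cell g r c)) (allFin (suc n)) ≡ᵇ (if toℕ c ≡ᵇ 0 then 0 else 1)
  pL : Fin (suc n) → Fin (suc k) → Bool
  pL r c = all (λ c' → not (toℕ c' <ᵇ toℕ c) ∨ isE (cell g r c')) (allFin (suc k))
  pD : Fin (suc n) → Fin (suc k) → Bool
  pD r c = all (λ r' → not (toℕ r <ᵇ toℕ r') ∨ isE (cell g r' c)) (allFin (suc n))
  pc : Fin (suc n) → Fin (suc k) → Bool
  pc r c = (not (isL (cell g r c)) ∨ pL r c) ∧ (not (isD (cell g r c)) ∨ pD r c)
  pR : Fin (suc n) → Bool
  pR r = all (pc r) (allFin (suc k))

  isPAT≡ : isPAT g ≡ rowsB ∧ (colsB ∧ ptB)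
  isPAT≡ = cong₂ _∧_
    (trans (all-tabulate (suc n) rowP id) (allF-cong (suc n) (λ r → cong (_≡ᵇ (if toℕ r ≡ᵇ n then 0 else 1)) (countB-tabulate (suc k) (λ c → isL (cell g r c)) id))))
    (cong₂ _∧_
      (trans (all-tabulate (suc k) colP id) (allF-cong (suc k) (λ c → cong (_≡ᵇ (if toℕ c ≡ᵇ 0 then 0 else 1)) (countB-tabulate (suc n) (λ r → isD (cell g r c)) id))))
      (trans (all-tabulate (suc n) pR id) (allF-cong (suc n) (λ r → trans (all-tabulate (suc k) (pc r) id) (allF-cong (suc k) (λ c →
         cong₂ (λ a b → (not (isL (cell g r c)) ∨ a) ∧ (not (isD (cell g r c)) ∨ b))
           (all-tabulate (suc k) (λ c' → not (toℕ c' <ᵇ toℕ c) ∨ isE (cell g r c')) id)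
           (all-tabulate (suc n) (λ r' → not (toℕ r <ᵇ toℕ r') ∨ isE (cell g r' c)) id)))))))

module _ {n k : ℕ} (g : Grid n k) where
  RowCond ColCond PtL PtD : Set
  RowCond = ∀ r → sumF (suc k) (λ c → ⟦ isL (cell g r c) ⟧) ≡ (if toℕ r ≡ᵇ n then 0 else 1)
  ColCond = ∀ c → sumF (suc n) (λ r → ⟦ isD (cell g r c) ⟧) ≡ (if toℕ c ≡ᵇ 0 then 0 else 1)
  PtL = ∀ r c → isL (cell g r c) ≡ true → ∀ c' → toℕ c' < toℕ c → isE (cell g r c') ≡ true
  PtD = ∀ r c → isD (cell g r c) ≡ true → ∀ r' → toℕ r < toℕ r' → isE (cell g r' c) ≡ true

  PAT-elim : isPAT g ≡ true → RowCond × ColCond × PtL × PtD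
  PAT-elim e with ∧-elim {rowsB g} {colsB g ∧ ptB g} (trans (sym (isPAT≡ g)) e)
  ... | er , e2 with ∧-elim {colsB g} {ptB g} e2
  ... | ec , ep = rowCond , colCond , pl , pd where
    rowCond : RowCond
    rowCond r = ≡ᵇ≡true⇒≡ _ _ (allF-elim (suc n) (rowQ g) er r)
    colCond : ColCond
    colCond c = ≡ᵇ≡true⇒≡ _ _ (allF-elim (suc k) (colQ g) ec c)
    pcell : ∀ r c → ptQ g r c ≡ true
    pcell r c = allF-elim (suc k) (ptQ g r) (allF-elim (suc n) (λ r → allF (suc k) (ptQ g r)) ep r) c
    pl : PtL
    pl r c eL c' lt = impl-elim (allF-elim (suc k) (ptLQ g r c) (impl-elim (proj₁ (∧-elim {not (isL (cell g r c)) ∨ allF (suc k) (ptLQ g r c)} (pcell r c))) eL) c') (<⇒<ᵇ≡true _ _ lt)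
    pd : PtD
    pd r c eD r' lt = impl-elim (allF-elim (suc n) (ptDQ g r c) (impl-elim (proj₂ (∧-elim {not (isL (cell g r c)) ∨ allF (suc k) (ptLQ g r c)} (pcell r c))) eD) r') (<⇒<ᵇ≡true _ _ lt)

  PAT-intro : RowCond → ColCond → PtL → PtD → isPAT g ≡ true
  PAT-intro rowCond colCond pl pd = trans (isPAT≡ g) (∧-intro
    (allF-true (suc n) (rowQ g) (λ r → ≡⇒≡ᵇ≡true _ _ (rowCond r)))
    (∧-intro (allF-true (suc k) (colQ g) (λ c → ≡⇒≡ᵇ≡true _ _ (colCond c)))
      (allF-true (suc n) (λ r → allF (suc k) (ptQ g r)) (λ r → allF-true (suc k) (ptQ g r) (λ c → ∧-intro
        (impl-intro (λ eL → allF-true (suc k) (ptLQ g r c) (λ c' → impl-intro (λ lt → pl r c eL c' (<ᵇ≡true⇒< _ _ lt)))))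
        (impl-intro (λ eD → allF-true (suc n) (ptDQ g r c) (λ r' → impl-intro (λ lt → pd r c eD r' (<ᵇ≡true⇒< _ _ lt))))))))))

-- Row r of the tableau is the red vertex (opposite r), so the bottom row is 0^r, and column c is
-- the blue vertex c. A red vertex i ≥ 1 puts its ← in its own row and its parent's column, a blue
-- vertex j ≥ 1 puts its ↓ in its own column and its parent's row.
module Encode {n k : ℕ} (t : ParentData n k) where
  pr = proj₁ t
  pb = proj₂ t

  hasLeft : Fin (suc n) → Fin (suc k) → Bool
  hasLeft zero c = false
  hasLeft (suc i) c = lookup pr i ≡ᶠ c

  hasDown : Fin (suc k) → Fin (suc n) → Bool
  hasDown zero r = false
  hasDown (suc j) r = opposite (lookup pb j) ≡ᶠ r

  isLeftAt : Fin (suc n) → Fin (suc k) → Bool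
  isLeftAt r c = hasLeft (opposite r) c

  isDownAt : Fin (suc n) → Fin (suc k) → Bool
  isDownAt r c = hasDown c r

  encodeCell : Fin (suc n) → Fin (suc k) → Cell
  encodeCell r c = if isLeftAt r c then larrow else (if isDownAt r c then darrow else empty)

  toGrid : Grid n k
  toGrid = V.tabulate (λ r → V.tabulate (λ c → encodeCell r c))

  cell-toGrid : ∀ r c → cell toGrid r c ≡ encodeCell r c
  cell-toGrid r c = trans (cong (λ v → lookup v c) (lookup∘tabulate (λ r → V.tabulate (λ c → encodeCell r c)) r)) (lookup∘tabulate (λ c → encodeCell r c) c)

  isL-toGrid : ∀ r c → isL (cell toGrid r c) ≡ isLeftAt r c
  isL-toGrid r c rewrite cell-toGrid r c with isLeftAt r c
  ... | true = refl
  ... | false with isDownAt r c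
  ... | true = refl
  ... | false = refl

  isD-toGrid : ∀ r c → isD (cell toGrid r c) ≡ not (isLeftAt r c) ∧ isDownAt r c
  isD-toGrid r c rewrite cell-toGrid r c with isLeftAt r c
  ... | true = refl
  ... | false with isDownAt r c
  ... | true = refl
  ... | false = refl

  isE-toGrid : ∀ r c → isE (cell toGrid r c) ≡ not (isLeftAt r c) ∧ not (isDownAt r c)
  isE-toGrid r c rewrite cell-toGrid r c with isLeftAt r c
  ... | true = refl
  ... | false with isDownAt r c
  ... | true = refl
  ... | false = refl

fromGrid : ∀ {n k} → Grid n k → ParentData n k
fromGrid g = V.tabulate (λ i → firstTrue (λ c → isL (cell g (opposite (suc i)) c))) ,
        V.tabulate (λ j → opposite (firstTrue (λ r → isD (cell g r (suc j)))))

no-2-cycle : ∀ {n k} (t : ParentData n k) → grandparentsOK t ≡ true → ∀ j → Encode.hasLeft t (lookup (proj₂ t) j) (suc j) ≡ false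
no-2-cycle t gt j with lookup (proj₂ t) j in eq
... | zero = refl
... | suc i with lookup (proj₁ t) i ≡ᶠ suc j in e2
... | false = refl
... | true = ⊥-elim (<⇒≱ (s≤s ≤-refl) (subst (_≤ toℕ i) (cong toℕ eq) (GrandparentsOK.redGrandparent≤ t gt i j (≡ᶠ-sound _ _ e2))))

fromGrid∘toGrid : ∀ {n k} (t : ParentData n k) → grandparentsOK t ≡ true → fromGrid (Encode.toGrid t) ≡ t
fromGrid∘toGrid {n} {k} t gt = cong₂ _,_ reds blues where
  open Encode t
  reds : V.tabulate (λ i → firstTrue (λ c → isL (cell toGrid (opposite (suc i)) c))) ≡ pr
  reds = trans (tabulate-cong (λ i → firstTrue-unique (λ c → isL (cell toGrid (opposite (suc i)) c)) (lookup pr i) (trans (isL-row i (lookup pr i)) (≡ᶠ-refl (lookup pr i)))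
                  (λ c' e → sym (≡ᶠ-sound (lookup pr i) c' (trans (sym (isL-row i c')) e))))) (tabulate∘lookup pr) where
    isL-row : ∀ i c → isL (cell toGrid (opposite (suc i)) c) ≡ (lookup pr i ≡ᶠ c)
    isL-row i c = trans (isL-toGrid (opposite (suc i)) c) (cong (λ a → hasLeft a c) (opposite-involutive (suc i)))
  blues : V.tabulate (λ j → opposite (firstTrue (λ r → isD (cell toGrid r (suc j))))) ≡ pb
  blues = trans (tabulate-cong (λ j → trans (cong opposite (firstTrue≡ j)) (opposite-involutive (lookup pb j)))) (tabulate∘lookup pb) where
    isD-at-parent : ∀ j → isD (cell toGrid (opposite (lookup pb j)) (suc j)) ≡ true
    isD-at-parent j = trans (isD-toGrid (opposite (lookup pb j)) (suc j)) (cong₂ (λ a b → not a ∧ b)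
             (trans (cong (λ a → hasLeft a (suc j)) (opposite-involutive (lookup pb j))) (no-2-cycle t gt j)) (≡ᶠ-refl (opposite (lookup pb j))))
    isD-only-at-parent : ∀ j r → isD (cell toGrid r (suc j)) ≡ true → r ≡ opposite (lookup pb j)
    isD-only-at-parent j r e = sym (≡ᶠ-sound (opposite (lookup pb j)) r (proj₂ (∧-elim {not (isLeftAt r (suc j))} (trans (sym (isD-toGrid r (suc j))) e))))
    firstTrue≡ : ∀ j → firstTrue (λ r → isD (cell toGrid r (suc j))) ≡ opposite (lookup pb j)
    firstTrue≡ j = firstTrue-unique (λ r → isD (cell toGrid r (suc j))) (opposite (lookup pb j)) (isD-at-parent j) (isD-only-at-parent j)

toGrid∘fromGrid : ∀ {n k} (g : Grid n k) → isPAT g ≡ true → Encode.toGrid (fromGrid g) ≡ g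
toGrid∘fromGrid {n} {k} g pg = trans (tabulate-cong (λ r → trans (tabulate-cong (λ c → cell-eq r c)) (tabulate∘lookup (lookup g r))))
                        (tabulate∘lookup g) where
  d = fromGrid g
  open Encode d using (isLeftAt; isDownAt; encodeCell; hasLeft; hasDown)
  conditions = PAT-elim g pg
  rowCond = proj₁ conditions
  colCond = proj₁ (proj₂ conditions)
  rowCond′ : ∀ r → sumF (suc k) (λ c → ⟦ isL (cell g r c) ⟧) ≡ (if isZero (opposite r) then 0 else 1)
  rowCond′ r = trans (rowCond r) (cong (λ b → if b then 0 else 1) (≡ᵇ-bottom r))
  isLeftAt-matches : ∀ r c → isLeftAt r c ≡ isL (cell g r c)
  isLeftAt-matches r c with opposite r in eq
  ... | zero = sym (count0⇒false (suc k) (λ c → isL (cell g r c)) (subst (λ z → sumF (suc k) (λ c → ⟦ isL (cell g r c) ⟧) ≡ (if isZero z then 0 else 1)) eq (rowCond′ r)) c)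
  ... | suc i = trans (cong (_≡ᶠ c) (trans (lookup∘tabulate (λ i → firstTrue (λ c → isL (cell g (opposite (suc i)) c))) i) (cong (λ z → firstTrue (λ c → isL (cell g z c))) rr)))
                      (sym (count1⇒firstTrue k (λ c → isL (cell g r c)) (subst (λ z → sumF (suc k) (λ c → ⟦ isL (cell g r c) ⟧) ≡ (if isZero z then 0 else 1)) eq (rowCond′ r)) c))
    where
    rr : opposite (suc i) ≡ r
    rr = trans (cong opposite (sym eq)) (opposite-involutive r)
  isDownAt-matches : ∀ r c → isDownAt r c ≡ isD (cell g r c)
  isDownAt-matches r zero = sym (count0⇒false (suc n) (λ r → isD (cell g r zero)) (colCond zero) r)
  isDownAt-matches r (suc j) = trans (cong (_≡ᶠ r) (trans (cong opposite (lookup∘tabulate (λ j → opposite (firstTrue (λ r → isD (cell g r (suc j))))) j)) (opposite-involutive (firstTrue (λ r → isD (cell g r (suc j)))))))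
                           (sym (count1⇒firstTrue n (λ r → isD (cell g r (suc j))) (colCond (suc j)) r))
  cell-eq : ∀ r c → encodeCell r c ≡ lookup (lookup g r) c
  cell-eq r c rewrite isLeftAt-matches r c | isDownAt-matches r c with lookup (lookup g r) c
  ... | empty = refl
  ... | larrow = refl
  ... | darrow = refl

L-notE : ∀ x → isL x ≡ true → isE x ≡ true → ⊥
L-notE larrow _ ()

D-notE : ∀ x → isD x ≡ true → isE x ≡ true → ⊥
D-notE darrow _ ()

L-notD : ∀ x → isL x ≡ true → isD x ≡ true → ⊥
L-notD larrow _ ()

module EncodeProps {n k : ℕ} (t : ParentData n k) where
  open Encode t

  isLeftAt-opposite : ∀ a c → isLeftAt (opposite a) c ≡ hasLeft a c
  isLeftAt-opposite a c = cong (λ z → hasLeft z c) (opposite-involutive a)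

  leftCount : ∀ a → sumF (suc k) (λ c → ⟦ hasLeft a c ⟧) ≡ (if isZero a then 0 else 1)
  leftCount zero = sumF-zero (suc k) _ (λ c → refl)
  leftCount (suc i) = trans (sumF-cong (suc k) (λ c → cong ⟦_⟧ (≡ᶠ-sym (lookup pr i) c))) (sumF-≡ᶠ (suc k) (lookup pr i))

  module Valid (gt : grandparentsOK t ≡ true) where
    redGrandparent≤′ = GrandparentsOK.redGrandparent≤ t gt
    blueGrandparent≤′ = GrandparentsOK.blueGrandparent≤ t gt

    left-blocks-left : ∀ a c → hasLeft a c ≡ true → ∀ c' → toℕ c' < toℕ c → hasLeft a c' ≡ false
    left-blocks-left (suc i) c e c' lt = false-by (λ e' → <⇒≢ lt (cong toℕ (trans (sym (≡ᶠ-sound (lookup pr i) c' e')) (≡ᶠ-sound (lookup pr i) c e))))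

    left-blocks-down : ∀ r c → hasLeft (opposite r) c ≡ true → ∀ c' → toℕ c' < toℕ c → isDownAt r c' ≡ false
    left-blocks-down r c eL zero lt = refl
    left-blocks-down r c eL (suc j') lt = false-by (λ e' → contradicts (opposite r) refl eL (≡ᶠ-sound _ _ e')) where
      contradicts : ∀ a → opposite r ≡ a → hasLeft a c ≡ true → opposite (lookup pb j') ≡ r → ⊥
      contradicts (suc i) eo e e' = <⇒≱ lt (≤-trans (≤-reflexive (cong toℕ (sym (≡ᶠ-sound _ _ e)))) (≤-trans (blueGrandparent≤′ j' i pbj) (n≤1+n _))) where
        pbj : lookup pb j' ≡ suc i
        pbj = trans (sym (opposite-involutive (lookup pb j'))) (trans (cong opposite e') eo)

    down-blocks-down : ∀ r c → isDownAt r c ≡ true → ∀ r' → toℕ r < toℕ r' → isDownAt r' c ≡ false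
    down-blocks-down r (suc j) e r' lt = false-by (λ e' → <⇒≢ lt (cong toℕ (trans (sym (≡ᶠ-sound (opposite (lookup pb j)) r e)) (≡ᶠ-sound (opposite (lookup pb j)) r' e'))))

    down-blocks-left : ∀ r c → isDownAt r c ≡ true → ∀ r' → toℕ r < toℕ r' → isLeftAt r' c ≡ false
    down-blocks-left r (suc j) e r' lt = by-row (opposite r') refl where
      opr : opposite r ≡ lookup pb j
      opr = trans (cong opposite (sym (≡ᶠ-sound (opposite (lookup pb j)) r e))) (opposite-involutive (lookup pb j))
      by-row : ∀ a → opposite r' ≡ a → hasLeft a (suc j) ≡ false
      by-row zero eo = refl
      by-row (suc i') eo = false-by (λ e' → <⇒≱ (h e') (n≤1+n (toℕ i'))) where
        h : (lookup pr i' ≡ᶠ suc j) ≡ true → suc (toℕ i') < toℕ i'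
        h e' = <-≤-trans (subst₂ (λ a b → toℕ a < toℕ b) eo opr (opposite-< r r' lt)) (redGrandparent≤′ i' j (≡ᶠ-sound _ _ e'))

  grandparentsOK⇒isPAT : grandparentsOK t ≡ true → isPAT toGrid ≡ true
  grandparentsOK⇒isPAT gt = PAT-intro toGrid rowsOK colsOK leftsOK downsOK where
    open Valid gt
    rowsOK : RowCond toGrid
    rowsOK r = trans (sumF-cong (suc k) (λ c → cong ⟦_⟧ (isL-toGrid r c)))
      (trans (leftCount (opposite r)) (cong (λ b → if b then 0 else 1) (sym (≡ᵇ-bottom r))))
    colsOK : ColCond toGrid
    colsOK zero = sumF-zero (suc n) _ (λ r → cong ⟦_⟧ (trans (isD-toGrid r zero) (∧-zeroʳ _)))
    colsOK (suc j) = trans (sumF-cong (suc n) downAt) (trans (sumF-cong (suc n) (λ r → cong ⟦_⟧ (≡ᶠ-sym (opposite (lookup pb j)) r)))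
                     (sumF-≡ᶠ (suc n) (opposite (lookup pb j)))) where
      downAt : ∀ r → ⟦ isD (cell toGrid r (suc j)) ⟧ ≡ ⟦ opposite (lookup pb j) ≡ᶠ r ⟧
      downAt r rewrite isD-toGrid r (suc j) with opposite (lookup pb j) ≡ᶠ r in e
      ... | false = cong ⟦_⟧ (∧-zeroʳ _)
      ... | true = cong (λ b → ⟦ not b ∧ true ⟧) (trans (cong (λ z → hasLeft (opposite z) (suc j)) (sym (≡ᶠ-sound (opposite (lookup pb j)) r e)))
                     (trans (isLeftAt-opposite (lookup pb j) (suc j)) (no-2-cycle t gt j)))
    leftsOK : PtL toGrid
    leftsOK r c eL c' lt = trans (isE-toGrid r c') (∧-intro (cong not (left-blocks-left (opposite r) c eL' c' lt)) (cong not (left-blocks-down r c eL' c' lt))) where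
      eL' : hasLeft (opposite r) c ≡ true
      eL' = trans (sym (isL-toGrid r c)) eL
    downsOK : PtD toGrid
    downsOK r c eD r' lt = trans (isE-toGrid r' c) (∧-intro (cong not (down-blocks-left r c eDt r' lt)) (cong not (down-blocks-down r c eDt r' lt))) where
      eDt : isDownAt r c ≡ true
      eDt = proj₂ (∧-elim {not (isLeftAt r c)} (trans (sym (isD-toGrid r c)) eD))

  module FromPAT (p : isPAT toGrid ≡ true) where
    conditions = PAT-elim toGrid p
    colCond = proj₁ (proj₂ conditions)
    leftsEmpty = proj₁ (proj₂ (proj₂ conditions))
    downsEmpty = proj₂ (proj₂ (proj₂ conditions))

    no-2-cycle′ : ∀ j → hasLeft (lookup pb j) (suc j) ≡ false
    no-2-cycle′ j = false-by (λ e → 1+n≢0 (trans (sym (colCond (suc j))) (sumF-zero (suc n) _ (λ r → cong ⟦_⟧ (noDown e r))))) where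
      noDown : hasLeft (lookup pb j) (suc j) ≡ true → ∀ r → isD (cell toGrid r (suc j)) ≡ false
      noDown e r rewrite isD-toGrid r (suc j) with opposite (lookup pb j) ≡ᶠ r in e2
      ... | false = ∧-zeroʳ _
      ... | true = cong (λ b → not b ∧ true) (trans (cong (λ z → hasLeft (opposite z) (suc j)) (sym (≡ᶠ-sound (opposite (lookup pb j)) r e2)))
                     (trans (isLeftAt-opposite (lookup pb j) (suc j)) e))

    isD-at-parent′ : ∀ j → isD (cell toGrid (opposite (lookup pb j)) (suc j)) ≡ true
    isD-at-parent′ j = trans (isD-toGrid _ (suc j))
      (cong₂ (λ a b → not a ∧ b) (trans (isLeftAt-opposite (lookup pb j) (suc j)) (no-2-cycle′ j)) (≡ᶠ-refl (opposite (lookup pb j))))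

    redOK-holds : ∀ i → redOK pb i (lookup pr i) ≡ true
    redOK-holds i with lookup pr i in eq
    ... | zero = refl
    ... | suc j = ≤⇒≤ᵇ≡true _ _ (≤-pred (subst₂ (λ a b → toℕ a < toℕ b) (opposite-involutive (lookup pb j)) (opposite-involutive (suc i)) (opposite-< r r0 lt))) where
      r = opposite (suc i)
      r0 = opposite (lookup pb j)
      Lr : isL (cell toGrid r (suc j)) ≡ true
      Lr = trans (isL-toGrid r (suc j)) (trans (isLeftAt-opposite (suc i) (suc j)) (trans (cong (_≡ᶠ suc j) eq) (≡ᶠ-refl (suc j))))
      notlt : toℕ r0 < toℕ r → ⊥
      notlt lt = L-notE _ Lr (downsEmpty r0 (suc j) (isD-at-parent′ j) r lt)
      neq : toℕ r ≢ toℕ r0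
      neq e = L-notD _ (subst (λ z → isL (cell toGrid z (suc j)) ≡ true) (toℕ-injective e) Lr) (isD-at-parent′ j)
      lt : toℕ r < toℕ r0
      lt = ≤∧≢⇒< (≮⇒≥ notlt) neq

    blueOK-holds : ∀ j → blueOK pr j (lookup pb j) ≡ true
    blueOK-holds j with lookup pb j in eq
    ... | zero = refl
    ... | suc i = ≤⇒≤ᵇ≡true _ _ (≤-pred (≤∧≢⇒< (≮⇒≥ notlt) neq)) where
      r0 = opposite (lookup pb j)
      Lr0 : isL (cell toGrid r0 (lookup pr i)) ≡ true
      Lr0 = trans (isL-toGrid r0 (lookup pr i)) (trans (isLeftAt-opposite (lookup pb j) (lookup pr i))
              (trans (cong (λ z → hasLeft z (lookup pr i)) eq) (≡ᶠ-refl (lookup pr i))))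
      notlt : toℕ (Fin.suc j) < toℕ (lookup pr i) → ⊥
      notlt lt = D-notE _ (isD-at-parent′ j) (leftsEmpty r0 (lookup pr i) Lr0 (suc j) lt)
      neq : toℕ (lookup pr i) ≢ toℕ (Fin.suc j)
      neq e = L-notD _ (subst (λ z → isL (cell toGrid r0 z) ≡ true) (toℕ-injective e) Lr0) (isD-at-parent′ j)

  isPAT⇒grandparentsOK : isPAT toGrid ≡ true → grandparentsOK t ≡ true
  isPAT⇒grandparentsOK p = ∧-intro (allF-true n _ redOK-holds) (allF-true k _ blueOK-holds)
    where open FromPAT p

  isPAT-toGrid : isPAT toGrid ≡ grandparentsOK t
  isPAT-toGrid = bool-ext isPAT⇒grandparentsOK grandparentsOK⇒isPAT

anyF-opposite : ∀ n (p : Fin (suc n) → Bool) → anyF (suc n) (λ r → p (opposite r)) ≡ anyF (suc n) p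
anyF-opposite n p = bool-ext
  (λ e → let (r , pr) = anyF-elim (suc n) (λ r → p (opposite r)) e in anyF-intro (suc n) p (opposite r) pr)
  (λ e → let (a , pa) = anyF-elim (suc n) p e in
         anyF-intro (suc n) (λ r → p (opposite r)) (opposite a) (subst (λ z → p z ≡ true) (sym (opposite-involutive a)) pa))

opposite≡ᶠfromℕ : ∀ n (x : Fin (suc n)) → (opposite x ≡ᶠ fromℕ n) ≡ (x ≡ᶠ zero)
opposite≡ᶠfromℕ n x = bool-ext
  (λ e → subst (λ z → (z ≡ᶠ zero) ≡ true)
     (trans (sym (opposite-fromℕ n)) (trans (cong opposite (sym (≡ᶠ-sound (opposite x) (fromℕ n) e))) (opposite-involutive x))) (≡ᶠ-refl {suc n} zero))
  (λ e → subst (λ z → (opposite z ≡ᶠ fromℕ n) ≡ true) (sym (≡ᶠ-sound x zero e)) (≡ᶠ-refl (fromℕ n)))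

wL-toGrid : ∀ {n k} (t : ParentData n k) → wL (Encode.toGrid t) ≡ wch′ t
wL-toGrid {n} {k} t = trans (countB-tabulate (suc k) _ id) (trans (sumF-cong (suc k) column) (cong₂ _+_ (cong ⟦_⟧ (∧-zeroʳ _))
    (sumF-cong k (λ j → cong ⟦_⟧ (trans (cong (anyF n (λ i → lookup pr i ≡ᶠ suc j) ∧_) (opposite≡ᶠfromℕ n (lookup pb j)))
                                        (∧-comm (anyF n (λ i → lookup pr i ≡ᶠ suc j)) (lookup pb j ≡ᶠ zero))))))) where
  open Encode t
  column : ∀ c → ⟦ any (λ r → isL (cell toGrid r c)) (allFin (suc n)) ∧ isD (cell toGrid (fromℕ n) c) ⟧
           ≡ ⟦ anyF (suc n) (λ a → hasLeft a c) ∧ hasDown c (fromℕ n) ⟧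
  column c = cong₂ (λ a b → ⟦ a ∧ b ⟧)
    (trans (any-tabulate (suc n) _ id) (trans (anyF-cong (suc n) (λ r → isL-toGrid r c)) (anyF-opposite n (λ a → hasLeft a c))))
    (trans (isD-toGrid (fromℕ n) c) (cong (λ z → not (hasLeft z c) ∧ hasDown c (fromℕ n)) (opposite-fromℕ n)))

_≟ᶜ_ : DecidableEquality Cell
empty ≟ᶜ empty = yes refl
empty ≟ᶜ larrow = no λ ()
empty ≟ᶜ darrow = no λ ()
larrow ≟ᶜ empty = no λ ()
larrow ≟ᶜ larrow = yes refl
larrow ≟ᶜ darrow = no λ ()
darrow ≟ᶜ empty = no λ ()
darrow ≟ᶜ larrow = no λ ()
darrow ≟ᶜ darrow = yes refl

cells : List Cell
cells = empty ∷ larrow ∷ darrow ∷ []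

cells-enumerate : Enumerates _≟ᶜ_ cells
cells-enumerate empty = refl
cells-enumerate larrow = refl
cells-enumerate darrow = refl

_≟ᴳ_ : ∀ {n k} → DecidableEquality (Grid n k)
_≟ᴳ_ = ≡-dec (≡-dec _≟ᶜ_)

_≟ᵀ_ : ∀ {n k} → DecidableEquality (ParentData n k)
_≟ᵀ_ = ≡-dec _≟ᶠ_ ×-≟ ≡-dec _≟ᶠ_

allGrids-enumerates : ∀ n k → Enumerates _≟ᴳ_ (allGrids n k)
allGrids-enumerates n k =
  allVec-enumerates {_≟_ = ≡-dec _≟ᶜ_} {allVec cells (suc k)} (allVec-enumerates {_≟_ = _≟ᶜ_} {cells} cells-enumerate (suc k)) (suc n)

allParentData-enumerates : ∀ n k → Enumerates _≟ᵀ_ (allParentData n k)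
allParentData-enumerates n k =
  pairs-enumerate {_≟A_ = ≡-dec _≟ᶠ_} {≡-dec _≟ᶠ_} {allVec (allFin (suc k)) n} {allVec (allFin (suc n)) k}
    (allVec-enumerates {_≟_ = _≟ᶠ_} {allFin (suc k)} (allFin-enumerates (suc k)) n)
    (allVec-enumerates {_≟_ = _≟ᶠ_} {allFin (suc n)} (allFin-enumerates (suc n)) k)

tabCoeff≡localCount : ∀ n k m → tabCoeff n k m ≡ localCount n k m
tabCoeff≡localCount n k m =
  countB-bijection {_≟A_ = _≟ᴳ_} {_≟ᵀ_} {allGrids n k} {allParentData n k} (allGrids-enumerates n k) (allParentData-enumerates n k)
    (λ g → isPAT g ∧ (wL g ≡ᵇ m)) (λ t → grandparentsOK t ∧ (wch′ t ≡ᵇ m)) Encode.toGrid fromGrid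
    (λ t → cong₂ (λ a b → a ∧ (b ≡ᵇ m)) (EncodeProps.isPAT-toGrid t) (wL-toGrid t))
    (λ g e → toGrid∘fromGrid g (proj₁ (∧-elim {isPAT g} e)))
    (λ t e → fromGrid∘toGrid t (proj₁ (∧-elim {grandparentsOK t} e)))

treeCoeff≡localCount : ∀ n k m → treeCoeff n k m ≡ localCount n k m
treeCoeff≡localCount n k m = countB-cong (allParentData n k)
  (λ t → cong₂ (λ a b → a ∧ (b ≡ᵇ m)) (isDAT≡grandparentsOK t) (wch≡wch′ t))

localCount≡coeffBhat : ∀ n k m → localCount n k m ≡ coeff (Bhat n k) m
localCount≡coeffBhat n k m = trans (localCount≡Trow n k m) (trans (Trow≡bhatCoeff k n m) (sym (coeff-Bhat n k m)))

theorem3p6 : ∀ (n k m : ℕ) →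
    (treeCoeff n k m ≡ tabCoeff n k m) × (tabCoeff n k m ≡ coeff (Bhat n k) m)
theorem3p6 n k m = trans (treeCoeff≡localCount n k m) (sym (tabCoeff≡localCount n k m)) , trans (tabCoeff≡localCount n k m) (localCount≡coeffBhat n k m)
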